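{- Let $k\ge1$, $p\in[0,1]$, and let $\sigma$ be a set of $k+1$ vertices of $G_{n,p}$. Conditional on $\sigma$ being a clique in $G_{n,p}$, the random variable $\deg(\sigma)-d_{\mathrm{up}}(\sigma)$ (computed in the clique complex of $G_{n,p}$) can be expressed as $$\deg(\sigma)-d_{\mathrm{up}}(\sigma)=\sum_{t\in\{1,\dots,n\}\setminus\sigma}X_t,$$ where the $X_t$ are i.i.d. random variables taking the value $1$ with probability $(k+1)p^k(1-p)$, the value $-1$ with probability $p^{k+1}$, and the value $0$ with probability $1-(k+1)p^k(1-p)-p^{k+1}$.
   Context: The Erdős–Rényi random graph $G_{n,p}$ is the random graph on $\{1,\dots,n\}$ in which every edge occurs independently with probability $p$. The clique complex of a graph has as simplices the vertex sets of complete subgraphs; its $k$-simplices are the $(k+1)$-cliques. The up-degree $d_{\mathrm{up}}(\sigma)$ of a $k$-simplex $\sigma$ is the number of $(k+1)$-simplices containing it. The $k$-simplex graph has as vertices the $k$-simplices, with $\sigma\neq\tau$ adjacent iff $|\sigma\cap\tau|=k$ and $\sigma\cup\tau$ is not a simplex; $\deg(\sigma)$ is the degree of $\sigma$ in this graph. -}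

module Defs where

open import Level using (Level)
open import Data.Bool using (Bool; true; false; _∧_; _∨_; not; if_then_else_)
open import Data.Nat using (ℕ; zero; suc)
import Data.Nat.Properties as ℕP
open import Data.Integer as ℤ using (ℤ; +_; -[1+_])
import Data.Integer.Properties as ℤP
open import Data.Fin using (Fin; toℕ)
import Data.Fin.Properties as FinP
open import Data.Fin.Subset using (Subset; ∣_∣; _∩_; _∪_)
open import Data.Vec using (Vec; []; _∷_; lookup; toList)
open import Data.List using (List; []; _∷_; concatMap; filter; allFin; foldr)
open import Data.Product using (_×_; _,_)
open import Relation.Nullary.Decidable using (⌊_⌋)
open import Algebra.Bundles using (CommutativeRing)

allVecs : (m : ℕ) → List (Vec Bool m)
allVecs zero = [] ∷ []
allVecs (suc m) = concatMap (λ v → (true ∷ v) ∷ (false ∷ v) ∷ []) (allVecs m)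

count : {A : Set} → (A → Bool) → List A → ℕ
count P [] = 0
count P (x ∷ xs) = if P x then suc (count P xs) else count P xs

allB : {A : Set} → (A → Bool) → List A → Bool
allB P [] = true
allB P (x ∷ xs) = P x ∧ allB P xs

anyB : {A : Set} → (A → Bool) → List A → Bool
anyB P [] = false
anyB P (x ∷ xs) = P x ∨ anyB P xs

pairs : (n : ℕ) → List (Fin n × Fin n)
pairs n = concatMap (λ i → Data.List.map (λ j → (i , j))
                                (filter (λ j → i FinP.<? j) (allFin n)))
                    (allFin n)

-- a graph is an edge indicator for each unordered pair in 'pairs n'
Graph : ℕ → Set
Graph n = Vec Bool (Data.List.length (pairs n))

allGraphs : (n : ℕ) → List (Graph n)
allGraphs n = allVecs (Data.List.length (pairs n))

zipEdges : {n : ℕ} {m : ℕ} → List (Fin n × Fin n) → Vec Bool m → List (Bool × Fin n × Fin n)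
zipEdges [] _ = []
zipEdges (_ ∷ _) [] = []
zipEdges (e ∷ es) (b ∷ bs) = (b , e) ∷ zipEdges es bs

eqF : {n : ℕ} → Fin n → Fin n → Bool
eqF i j = ⌊ i FinP.≟ j ⌋

adj : {n : ℕ} → Graph n → Fin n → Fin n → Bool
adj {n} G i j = anyB (λ { (b , (u , v)) → b ∧ ((eqF i u ∧ eqF j v) ∨ (eqF i v ∧ eqF j u)) })
                     (zipEdges (pairs n) G)

_∈ᵇ_ : {n : ℕ} → Fin n → Subset n → Bool
i ∈ᵇ s = lookup s i

isClique : {n : ℕ} → Graph n → Subset n → Bool
isClique {n} G s = allB (λ { (i , j) → not (i ∈ᵇ s ∧ j ∈ᵇ s) ∨ adj G i j }) (pairs n)

_⊆ᵇ_ : {n : ℕ} → Subset n → Subset n → Bool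
_⊆ᵇ_ {n} s t = allB (λ i → not (i ∈ᵇ s) ∨ i ∈ᵇ t) (allFin n)

eqS : {n : ℕ} → Subset n → Subset n → Bool
eqS s t = (s ⊆ᵇ t) ∧ (t ⊆ᵇ s)

isSimplex : {n : ℕ} → ℕ → Graph n → Subset n → Bool
isSimplex k G s = ⌊ ∣ s ∣ ℕP.≟ suc k ⌋ ∧ isClique G s

dUp : {n : ℕ} → ℕ → Graph n → Subset n → ℕ
dUp {n} k G σ = count (λ τ → isSimplex (suc k) G τ ∧ (σ ⊆ᵇ τ)) (allVecs n)

degS : {n : ℕ} → ℕ → Graph n → Subset n → ℕ
degS {n} k G σ = count (λ τ → isSimplex k G τ ∧ not (eqS τ σ)
                              ∧ ⌊ ∣ σ ∩ τ ∣ ℕP.≟ k ⌋ ∧ not (isClique G (σ ∪ τ)))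
                       (allVecs n)

sumOutside : {n : ℕ} → Subset n → (Fin n → ℤ) → ℤ
sumOutside {n} σ f = foldr (λ t acc → (if t ∈ᵇ σ then + 0 else f t) ℤ.+ acc) (+ 0) (allFin n)

-- The G(n,p) measure, with p an element of an arbitrary commutative ring
-- (probabilities are polynomials in p).

module Prob {c ℓ : Level} (R : CommutativeRing c ℓ) where
  open CommutativeRing R

  ind : Bool → Carrier
  ind true = 1#
  ind false = 0#

  natR : ℕ → Carrier
  natR zero = 0#
  natR (suc m) = 1# + natR m

  powR : Carrier → ℕ → Carrier
  powR x zero = 1#
  powR x (suc m) = x * powR x m

  edgeW : Carrier → Bool → Carrier
  edgeW p true = p
  edgeW p false = 1# - p

  weight : (n : ℕ) → Carrier → Graph n → Carrier
  weight n p G = foldr (λ b acc → edgeW p b * acc) 1# (toList G)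

  Pr : (n : ℕ) → Carrier → (Graph n → Bool) → Carrier
  Pr n p E = foldr (λ G acc → weight n p G * ind (E G) + acc) 0# (allGraphs n)

  qLaw : ℕ → Carrier → ℤ → Carrier
  qLaw k p (+ 1) = natR (suc k) * powR p k * (1# - p)
  qLaw k p -[1+ 0 ] = powR p (suc k)
  qLaw k p (+ 0) = 1# - natR (suc k) * powR p k * (1# - p) - powR p (suc k)
  qLaw k p _ = 0#

  prodOutside : {n : ℕ} → Subset n → (Fin n → Carrier) → Carrier
  prodOutside {n} σ f = foldr (λ t acc → (if t ∈ᵇ σ then 1# else f t) * acc) 1# (allFin n)

-- A k-simplex τ adjacent to σ in the k-simplex graph
-- is σ with one vertex v exchanged for an outside vertex t that is adjacent to every vertex
-- of σ except v, and a (k+1)-simplex containing σ is σ plus an outside vertex adjacent to all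
-- of σ. Counting both by the outside vertex t gives deg σ − d_up σ = Σ_{t ∉ σ} X_t, where X_t
-- counts the admissible v (at most one) minus [t is adjacent to all of σ]. Each X_t depends
-- only on the edges from t to σ; these edge sets are pairwise disjoint and disjoint from the
-- edges inside σ, which decide whether σ is a clique, so in G(n, p) the events factor, and the
-- law of X_t is read off from the k + 1 independent edges between t and σ.

module Submission where

open import Defs
open import Data.Bool using (T; _∧_)
open import Data.Nat using (ℕ; suc; _≤_)
open import Data.Integer using (ℤ; +_; _-_)
import Data.Integer.Properties as ℤP
open import Data.Fin using (Fin)
open import Data.Fin.Subset using (Subset; ∣_∣)
open import Data.List using (allFin)
open import Data.Product using (Σ; _×_)
open import Relation.Binary.PropositionalEquality using (_≡_)
open import Relation.Nullary.Decidable using (⌊_⌋)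
open import Algebra.Bundles using (CommutativeRing)

open import Level using (Level)
open import Data.Bool using (Bool; true; false; _∨_; not; if_then_else_)
import Data.Bool as Bool
open import Data.Bool.Properties using (T?; ∧-comm; ∨-comm; ∧-identityʳ; ∧-zeroʳ)
open import Data.Empty using (⊥-elim)
open import Data.Unit using (⊤; tt)
open import Data.Nat using (zero; _<_)
import Data.Nat.Properties as ℕ
open import Data.Fin using (zero; suc; toℕ)
import Data.Fin.Properties as Fin
open import Data.Fin.Subset using (_∩_; _∪_)
open import Data.Integer using (-[1+_])
import Data.Integer as ℤ
open import Data.List using (List; []; _∷_; length; foldr; map; concatMap; filter)
import Data.List as List
open import Data.List.Properties using (map-cong)
open import Data.Nat.ListAction using (sum)
open import Data.List.Membership.Propositional using (_∈_)
open import Data.List.Membership.Propositional.Properties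
  using (∈-allFin; ∈-concatMap⁺; ∈-concatMap⁻; ∈-map⁺; ∈-map⁻; ∈-filter⁺; ∈-filter⁻)
open import Data.List.Relation.Unary.Any using (Any; here; there)
import Data.List.Relation.Unary.All as All
open import Data.List.Relation.Unary.AllPairs using (_∷_)
open import Data.List.Relation.Unary.Unique.Propositional using (Unique)
open import Data.List.Relation.Unary.Unique.Propositional.Properties using (allFin⁺)
open import Data.Vec using (Vec; []; _∷_; lookup; tabulate; toList)
open import Data.Vec.Properties using (≡-dec; lookup∘tabulate; lookup-zipWith; tabulate∘lookup; tabulate-cong)
open import Data.Product using (∃; ∃₂; _,_; proj₁; proj₂)
open import Data.Sum using (_⊎_; inj₁; inj₂; [_,_]′)
open import Function using (_∘_)
open import Relation.Binary.Definitions using (DecidableEquality; tri<; tri≈; tri>)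
open import Relation.Binary.PropositionalEquality as ≡ using (_≢_)
open import Relation.Nullary using (¬_; Dec; yes; no; does)
open import Relation.Nullary.Decidable using (toWitness; fromWitness)
import Algebra.Solver.Ring.NaturalCoefficients.Default as NaturalCoefficients

-- A separate module keeps ℕ's _+_ apart from the ring's _+_ used in Probability.
module Combinatorics where

  open import Data.Nat using (_+_)
  open import Data.Integer.Solver using (module +-*-Solver)
  open ≡ using (refl; sym; trans; cong; cong₂; subst; module ≡-Reasoning)

  ∧-intro : ∀ {a b} → T a → T b → T (a ∧ b)
  ∧-intro {true} _ y = y

  ∧-projˡ : ∀ {a b} → T (a ∧ b) → T a
  ∧-projˡ {true} _ = tt

  ∧-projʳ : ∀ {a b} → T (a ∧ b) → T b
  ∧-projʳ {true} y = y

  ∨-injˡ : ∀ {a b} → T a → T (a ∨ b)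
  ∨-injˡ {true} _ = tt

  ∨-injʳ : ∀ {a b} → T b → T (a ∨ b)
  ∨-injʳ {true} _ = tt
  ∨-injʳ {false} y = y

  ∨-case : ∀ {a b} → T (a ∨ b) → T a ⊎ T b
  ∨-case {true} _ = inj₁ tt
  ∨-case {false} y = inj₂ y

  T-ext : ∀ {a b} → (T a → T b) → (T b → T a) → a ≡ b
  T-ext {true} {true} _ _ = refl
  T-ext {true} {false} f _ = ⊥-elim (f tt)
  T-ext {false} {true} _ g = ⊥-elim (g tt)
  T-ext {false} {false} _ _ = refl

  not-intro : ∀ {b} → ¬ T b → T (not b)
  not-intro {true} h = h tt
  not-intro {false} _ = tt

  not-elim : ∀ {b} → T (not b) → ¬ T b
  not-elim {false} _ ()

  T⇒≡true : ∀ {b} → T b → b ≡ true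
  T⇒≡true {true} _ = refl

  ≡true⇒T : ∀ {b} → b ≡ true → T b
  ≡true⇒T refl = tt

  ¬T⇒≡false : ∀ {b} → ¬ T b → b ≡ false
  ¬T⇒≡false {true} h = ⊥-elim (h tt)
  ¬T⇒≡false {false} _ = refl

  ≡false⇒¬T : ∀ {b} → b ≡ false → ¬ T b
  ≡false⇒¬T refl ()

  ∧-congʳ-T : ∀ a {x y} → (T a → x ≡ y) → a ∧ x ≡ a ∧ y
  ∧-congʳ-T true x≡y = x≡y tt
  ∧-congʳ-T false _ = refl

  ∨-congʳ-¬T : ∀ a {x y} → (¬ T a → x ≡ y) → a ∨ x ≡ a ∨ y
  ∨-congʳ-¬T true _ = refl
  ∨-congʳ-¬T false x≡y = x≡y (λ ())

  not-∨-congʳ-T : ∀ a {x y} → (T a → x ≡ y) → not a ∨ x ≡ not a ∨ y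
  not-∨-congʳ-T true x≡y = x≡y tt
  not-∨-congʳ-T false _ = refl

  eqF-refl : ∀ {n} (i : Fin n) → T (eqF i i)
  eqF-refl i = fromWitness refl

  eqF⇒≡ : ∀ {n} {i j : Fin n} → T (eqF i j) → i ≡ j
  eqF⇒≡ = toWitness

  module _ {A : Set} where

    count-cong : {f g : A → Bool} → (∀ x → f x ≡ g x) → ∀ xs → count f xs ≡ count g xs
    count-cong f≗g [] = refl
    count-cong {g = g} f≗g (x ∷ xs) rewrite f≗g x with g x
    ... | true = cong suc (count-cong f≗g xs)
    ... | false = count-cong f≗g xs

    count-∨ : ∀ (f g : A → Bool) xs → (∀ x → ¬ (T (f x) × T (g x))) →
              count (λ x → f x ∨ g x) xs ≡ count f xs + count g xs
    count-∨ f g [] _ = refl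
    count-∨ f g (x ∷ xs) disj with f x in fx | g x in gx
    ... | true | true = ⊥-elim (disj x (≡true⇒T fx , ≡true⇒T gx))
    ... | true | false = cong suc (count-∨ f g xs disj)
    ... | false | true = trans (cong suc (count-∨ f g xs disj)) (sym (ℕ.+-suc _ _))
    ... | false | false = count-∨ f g xs disj

    count-split : ∀ (f g : A → Bool) xs →
                  count f xs ≡ count (λ x → f x ∧ g x) xs + count (λ x → f x ∧ not (g x)) xs
    count-split f g [] = refl
    count-split f g (x ∷ xs) with f x | g x
    ... | true | true = cong suc (count-split f g xs)
    ... | true | false = trans (cong suc (count-split f g xs)) (sym (ℕ.+-suc _ _))
    ... | false | _ = count-split f g xs

    count≡0 : ∀ (f : A → Bool) {xs} → (∀ {x} → x ∈ xs → ¬ T (f x)) → count f xs ≡ 0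
    count≡0 f {[]} _ = refl
    count≡0 f {x ∷ xs} h rewrite ¬T⇒≡false (h (here refl)) = count≡0 f (h ∘ there)

    count≡0⇒¬T : ∀ (f : A → Bool) {xs} → count f xs ≡ 0 → ∀ {x} → x ∈ xs → ¬ T (f x)
    count≡0⇒¬T f {y ∷ xs} c x∈ fx with f y in fy
    count≡0⇒¬T f {y ∷ xs} () x∈ fx | true
    count≡0⇒¬T f {y ∷ xs} c (here refl) fx | false = ≡false⇒¬T fy fx
    count≡0⇒¬T f {y ∷ xs} c (there x∈) fx | false = count≡0⇒¬T f c x∈ fx

    count≡1⇒unique : ∀ (f : A → Bool) xs → count f xs ≡ 1 →
                     ∃ λ x → T (f x) × (∀ {y} → y ∈ xs → T (f y) → y ≡ x)
    count≡1⇒unique f (x ∷ xs) c with f x in fx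
    ... | true = x , ≡true⇒T fx , λ where
            (here refl) _ → refl
            (there y∈) fy → ⊥-elim (count≡0⇒¬T f (ℕ.suc-injective c) y∈ fy)
    ... | false with count≡1⇒unique f xs c
    ... | z , fz , uniq = z , fz , λ where
            (here refl) fy → ⊥-elim (≡false⇒¬T fx fy)
            (there y∈) fy → uniq y∈ fy

    count≡1 : ∀ (f : A → Bool) {xs x} → Unique xs → x ∈ xs → T (f x) →
              (∀ {y} → y ∈ xs → T (f y) → y ≡ x) → count f xs ≡ 1
    count≡1 f {y ∷ xs} (y∉ ∷ uniq) (here refl) fx only rewrite T⇒≡true fx =
      cong suc (count≡0 f λ z∈ fz → All.lookup y∉ z∈ (sym (only (there z∈) fz)))
    count≡1 f {y ∷ xs} (y∉ ∷ uniq) (there x∈) fx only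
      rewrite ¬T⇒≡false (λ fy → All.lookup y∉ x∈ (only (here refl) fy)) =
      count≡1 f uniq x∈ fx (only ∘ there)

    anyB⇒∃ : ∀ (f : A → Bool) xs → T (anyB f xs) → ∃ λ x → x ∈ xs × T (f x)
    anyB⇒∃ f (x ∷ xs) h with ∨-case {f x} h
    ... | inj₁ fx = x , here refl , fx
    ... | inj₂ rest with anyB⇒∃ f xs rest
    ... | y , y∈ , fy = y , there y∈ , fy

    ∃⇒anyB : ∀ (f : A → Bool) {xs x} → x ∈ xs → T (f x) → T (anyB f xs)
    ∃⇒anyB f (here refl) fx = ∨-injˡ fx
    ∃⇒anyB f {y ∷ _} (there x∈) fx = ∨-injʳ {f y} (∃⇒anyB f x∈ fx)

    allB⇒∀ : ∀ (f : A → Bool) {xs} → T (allB f xs) → ∀ {x} → x ∈ xs → T (f x)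
    allB⇒∀ f h (here refl) = ∧-projˡ h
    allB⇒∀ f {y ∷ _} h (there x∈) = allB⇒∀ f (∧-projʳ {f y} h) x∈

    ∀⇒allB : ∀ (f : A → Bool) xs → (∀ {x} → x ∈ xs → T (f x)) → T (allB f xs)
    ∀⇒allB f [] _ = tt
    ∀⇒allB f (x ∷ xs) h = ∧-intro (h (here refl)) (∀⇒allB f xs (h ∘ there))

    count≡if-anyB : ∀ (f : A → Bool) {xs} → Unique xs →
                    (∀ {x y} → x ∈ xs → y ∈ xs → T (f x) → T (f y) → x ≡ y) →
                    count f xs ≡ (if anyB f xs then 1 else 0)
    count≡if-anyB f {xs} uniq functional with T? (anyB f xs)
    ... | yes some rewrite T⇒≡true some = let x , x∈ , fx = anyB⇒∃ f xs some in
            count≡1 f uniq x∈ fx (λ y∈ fy → functional y∈ x∈ fy fx)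
    ... | no none rewrite ¬T⇒≡false none = count≡0 f {xs} (λ x∈ fx → none (∃⇒anyB f x∈ fx))

    anyB-cong : {f g : A → Bool} → (∀ x → f x ≡ g x) → ∀ xs → anyB f xs ≡ anyB g xs
    anyB-cong f≗g [] = refl
    anyB-cong f≗g (x ∷ xs) = cong₂ _∨_ (f≗g x) (anyB-cong f≗g xs)

    allB-cong : {f g : A → Bool} → ∀ xs → (∀ {x} → x ∈ xs → f x ≡ g x) → allB f xs ≡ allB g xs
    allB-cong [] _ = refl
    allB-cong (x ∷ xs) f≗g = cong₂ _∧_ (f≗g (here refl)) (allB-cong xs (f≗g ∘ there))

    count≡sum : ∀ (f : A → Bool) xs → count f xs ≡ sum (map (λ x → if f x then 1 else 0) xs)
    count≡sum f [] = refl
    count≡sum f (x ∷ xs) with f x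
    ... | true = cong suc (count≡sum f xs)
    ... | false = count≡sum f xs

  count-anyB : ∀ {A X : Set} (R : X → A → Bool) xs → Unique xs →
               (∀ {x y a} → x ∈ xs → y ∈ xs → T (R x a) → T (R y a) → x ≡ y) →
               ∀ as → count (λ a → anyB (λ x → R x a) xs) as ≡ sum (map (λ x → count (R x) as) xs)
  count-anyB R [] _ _ as = count≡0 (λ _ → false) {as} (λ _ ())
  count-anyB R (x ∷ xs) (x∉ ∷ uniq) functional as =
    trans (count-∨ (R x) (λ a → anyB (λ y → R y a) xs) as disjoint)
          (cong (λ s → count (R x) as + s) (count-anyB R xs uniq (λ y∈ z∈ → functional (there y∈) (there z∈)) as))
    where
    disjoint : ∀ a → ¬ (T (R x a) × T (anyB (λ y → R y a) xs))
    disjoint a (Rxa , Rxsa) with anyB⇒∃ (λ y → R y a) xs Rxsa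
    ... | y , y∈ , Rya = All.lookup x∉ y∈ (functional (here refl) (there y∈) Rxa Rya)

  countFin : ∀ {n} → (Fin n → Bool) → ℕ
  countFin {n} f = count f (allFin n)

  count-tabulate : ∀ {A : Set} n (f : A → Bool) (g : Fin n → A) →
                   count f (List.tabulate g) ≡ countFin (f ∘ g)
  count-tabulate zero f g = refl
  count-tabulate (suc n) f g with f (g zero)
  ... | true = cong suc (trans (count-tabulate n f (g ∘ suc)) (sym (count-tabulate n (f ∘ g) suc)))
  ... | false = trans (count-tabulate n f (g ∘ suc)) (sym (count-tabulate n (f ∘ g) suc))

  ∣∣≡countFin : ∀ {n} (σ : Subset n) → ∣ σ ∣ ≡ countFin (lookup σ)
  ∣∣≡countFin [] = refl
  ∣∣≡countFin {suc n} (true ∷ σ) =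
    cong suc (trans (∣∣≡countFin σ) (sym (count-tabulate n (lookup (true ∷ σ)) suc)))
  ∣∣≡countFin {suc n} (false ∷ σ) =
    trans (∣∣≡countFin σ) (sym (count-tabulate n (lookup (false ∷ σ)) suc))

  countFin-eqF : ∀ {n} (t : Fin n) → countFin (λ w → eqF w t) ≡ 1
  countFin-eqF {n} t = count≡1 _ (allFin⁺ n) (∈-allFin t) (eqF-refl t) (λ _ → eqF⇒≡)

  tabulate-≗ : ∀ {n} (σ : Subset n) (f : Fin n → Bool) → (∀ w → lookup σ w ≡ f w) → σ ≡ tabulate f
  tabulate-≗ σ f σ≗f = trans (sym (tabulate∘lookup σ)) (tabulate-cong σ≗f)

  insert : ∀ {n} → Subset n → Fin n → Subset n
  insert σ t = tabulate (λ w → w ∈ᵇ σ ∨ eqF w t)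

  remove : ∀ {n} → Subset n → Fin n → Subset n
  remove σ v = tabulate (λ w → w ∈ᵇ σ ∧ not (eqF w v))

  swap : ∀ {n} → Subset n → Fin n → Fin n → Subset n
  swap σ v t = insert (remove σ v) t

  module _ {n : ℕ} where

    ∈-insert : ∀ (σ : Subset n) t w → w ∈ᵇ insert σ t ≡ w ∈ᵇ σ ∨ eqF w t
    ∈-insert σ t w = lookup∘tabulate _ w

    ∈-remove : ∀ (σ : Subset n) v w → w ∈ᵇ remove σ v ≡ w ∈ᵇ σ ∧ not (eqF w v)
    ∈-remove σ v w = lookup∘tabulate _ w

    ∈-swap : ∀ (σ : Subset n) v t w → w ∈ᵇ swap σ v t ≡ (w ∈ᵇ σ ∧ not (eqF w v)) ∨ eqF w t
    ∈-swap σ v t w = trans (∈-insert (remove σ v) t w) (cong (_∨ eqF w t) (∈-remove σ v w))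

    ∈-∩ : ∀ (σ τ : Subset n) w → w ∈ᵇ (σ ∩ τ) ≡ w ∈ᵇ σ ∧ w ∈ᵇ τ
    ∈-∩ σ τ w = lookup-zipWith _∧_ w σ τ

    ∈-∪ : ∀ (σ τ : Subset n) w → w ∈ᵇ (σ ∪ τ) ≡ w ∈ᵇ σ ∨ w ∈ᵇ τ
    ∈-∪ σ τ w = lookup-zipWith _∨_ w σ τ

    t∈insert : ∀ (σ : Subset n) t → T (t ∈ᵇ insert σ t)
    t∈insert σ t = subst T (sym (∈-insert σ t t)) (∨-injʳ {t ∈ᵇ σ} (eqF-refl t))

    ∈-insert⁻ : ∀ (σ : Subset n) t {w} → T (w ∈ᵇ insert σ t) → T (w ∈ᵇ σ) ⊎ w ≡ t
    ∈-insert⁻ σ t {w} h with ∨-case {w ∈ᵇ σ} (subst T (∈-insert σ t w) h)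
    ... | inj₁ w∈σ = inj₁ w∈σ
    ... | inj₂ w≡t = inj₂ (eqF⇒≡ w≡t)

    ∈-insert⁺ : ∀ (σ : Subset n) t {w} → T (w ∈ᵇ σ) → T (w ∈ᵇ insert σ t)
    ∈-insert⁺ σ t {w} w∈σ = subst T (sym (∈-insert σ t w)) (∨-injˡ w∈σ)

    ∈-remove⁻ : ∀ (σ : Subset n) v {w} → T (w ∈ᵇ remove σ v) → T (w ∈ᵇ σ) × w ≢ v
    ∈-remove⁻ σ v {w} h = ∧-projˡ h′ , λ { refl → not-elim (∧-projʳ {w ∈ᵇ σ} h′) (eqF-refl w) }
      where h′ = subst T (∈-remove σ v w) h

    ∈-remove⁺ : ∀ (σ : Subset n) v {w} → T (w ∈ᵇ σ) → w ≢ v → T (w ∈ᵇ remove σ v)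
    ∈-remove⁺ σ v {w} w∈σ w≢v =
      subst T (sym (∈-remove σ v w)) (∧-intro w∈σ (not-intro (w≢v ∘ eqF⇒≡)))

    ∣insert∣ : ∀ (σ : Subset n) t → ¬ T (t ∈ᵇ σ) → ∣ insert σ t ∣ ≡ suc ∣ σ ∣
    ∣insert∣ σ t t∉σ = begin
      ∣ insert σ t ∣                      ≡⟨ ∣∣≡countFin (insert σ t) ⟩
      countFin (λ w → w ∈ᵇ insert σ t)    ≡⟨ count-cong (∈-insert σ t) (allFin n) ⟩
      countFin (λ w → w ∈ᵇ σ ∨ eqF w t)   ≡⟨ count-∨ _ _ (allFin n) disjoint ⟩
      countFin (λ w → w ∈ᵇ σ) + countFin (λ w → eqF w t)
                                          ≡⟨ cong₂ _+_ (sym (∣∣≡countFin σ)) (countFin-eqF t) ⟩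
      (∣ σ ∣) + 1                         ≡⟨ ℕ.+-comm ∣ σ ∣ 1 ⟩
      suc ∣ σ ∣                           ∎
      where
      open ≡-Reasoning
      disjoint : ∀ w → ¬ (T (w ∈ᵇ σ) × T (eqF w t))
      disjoint w (w∈σ , w≡t) = t∉σ (subst (λ x → T (x ∈ᵇ σ)) (eqF⇒≡ w≡t) w∈σ)

    ∣remove∣ : ∀ (σ : Subset n) v → T (v ∈ᵇ σ) → suc ∣ remove σ v ∣ ≡ ∣ σ ∣
    ∣remove∣ σ v v∈σ = begin
      suc ∣ remove σ v ∣                        ≡⟨ cong suc (∣∣≡countFin (remove σ v)) ⟩
      suc (countFin (λ w → w ∈ᵇ remove σ v))    ≡⟨ cong suc (count-cong (∈-remove σ v) (allFin n)) ⟩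
      1 + countFin others                       ≡⟨ cong (_+ countFin others) (sym only-v) ⟩
      countFin (λ w → w ∈ᵇ σ ∧ eqF w v) + countFin others
                                                ≡⟨ sym (count-split _ (λ w → eqF w v) (allFin n)) ⟩
      countFin (λ w → w ∈ᵇ σ)                   ≡⟨ sym (∣∣≡countFin σ) ⟩
      ∣ σ ∣                                     ∎
      where
      open ≡-Reasoning
      others : Fin n → Bool
      others w = w ∈ᵇ σ ∧ not (eqF w v)
      only-v : countFin (λ w → w ∈ᵇ σ ∧ eqF w v) ≡ 1
      only-v = count≡1 _ (allFin⁺ n) (∈-allFin v) (∧-intro v∈σ (eqF-refl v)) (λ _ h → eqF⇒≡ (∧-projʳ h))

    ∈-∩⁻ : ∀ (σ τ : Subset n) {w} → T (w ∈ᵇ (σ ∩ τ)) → T (w ∈ᵇ σ) × T (w ∈ᵇ τ)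
    ∈-∩⁻ σ τ {w} h = ∧-projˡ h′ , ∧-projʳ {w ∈ᵇ σ} h′
      where h′ = subst T (∈-∩ σ τ w) h

    ∈-∩⁺ : ∀ (σ τ : Subset n) {w} → T (w ∈ᵇ σ) → T (w ∈ᵇ τ) → T (w ∈ᵇ (σ ∩ τ))
    ∈-∩⁺ σ τ {w} w∈σ w∈τ = subst T (sym (∈-∩ σ τ w)) (∧-intro w∈σ w∈τ)

  _⊆ᵗ_ : ∀ {n} → Subset n → Subset n → Set
  σ ⊆ᵗ τ = ∀ {w} → T (w ∈ᵇ σ) → T (w ∈ᵇ τ)

  module _ {n : ℕ} (σ τ : Subset n) where

    ⊆ᵇ⇒⊆ᵗ : T (σ ⊆ᵇ τ) → σ ⊆ᵗ τ
    ⊆ᵇ⇒⊆ᵗ σ⊆τ {w} w∈σ with ∨-case (allB⇒∀ _ σ⊆τ (∈-allFin w))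
    ... | inj₁ w∉σ = ⊥-elim (not-elim w∉σ w∈σ)
    ... | inj₂ w∈τ = w∈τ

    ⊆ᵗ⇒⊆ᵇ : σ ⊆ᵗ τ → T (σ ⊆ᵇ τ)
    ⊆ᵗ⇒⊆ᵇ σ⊆τ = ∀⇒allB _ (allFin n) membership
      where
      membership : ∀ {w} → w ∈ allFin n → T (not (w ∈ᵇ σ) ∨ w ∈ᵇ τ)
      membership {w} _ with T? (w ∈ᵇ σ)
      ... | yes w∈σ = ∨-injʳ {not (w ∈ᵇ σ)} (σ⊆τ w∈σ)
      ... | no w∉σ = ∨-injˡ (not-intro w∉σ)

  module _ {n : ℕ} where

    ⊆∧∣∣≡suc⇒insert : ∀ {σ τ : Subset n} → σ ⊆ᵗ τ → ∣ τ ∣ ≡ suc ∣ σ ∣ →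
                      ∃ λ t → ¬ T (t ∈ᵇ σ) × τ ≡ insert σ t
    ⊆∧∣∣≡suc⇒insert {σ} {τ} σ⊆τ ∣τ∣≡ = t , t∉σ , tabulate-≗ τ _ pointwise
      where
      open ≡-Reasoning
      old : countFin (λ w → w ∈ᵇ τ ∧ w ∈ᵇ σ) ≡ ∣ σ ∣
      old = trans (count-cong (λ w → T-ext ∧-projʳ (λ w∈σ → ∧-intro (σ⊆τ w∈σ) w∈σ)) (allFin n))
                  (sym (∣∣≡countFin σ))
      new : countFin (λ w → w ∈ᵇ τ ∧ not (w ∈ᵇ σ)) ≡ 1
      new = ℕ.+-cancelˡ-≡ ∣ σ ∣ _ 1 (begin
        (∣ σ ∣) + countFin (λ w → w ∈ᵇ τ ∧ not (w ∈ᵇ σ))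
          ≡⟨ cong (_+ countFin (λ w → w ∈ᵇ τ ∧ not (w ∈ᵇ σ))) (sym old) ⟩
        countFin (λ w → w ∈ᵇ τ ∧ w ∈ᵇ σ) + countFin (λ w → w ∈ᵇ τ ∧ not (w ∈ᵇ σ))
          ≡⟨ sym (count-split (λ w → w ∈ᵇ τ) (λ w → w ∈ᵇ σ) (allFin n)) ⟩
        countFin (λ w → w ∈ᵇ τ)      ≡⟨ sym (∣∣≡countFin τ) ⟩
        ∣ τ ∣                        ≡⟨ ∣τ∣≡ ⟩
        suc ∣ σ ∣                    ≡⟨ ℕ.+-comm 1 ∣ σ ∣ ⟩
        (∣ σ ∣) + 1                  ∎)
      unique = count≡1⇒unique _ (allFin n) new
      t = proj₁ unique
      t∉σ : ¬ T (t ∈ᵇ σ)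
      t∉σ = not-elim (∧-projʳ {t ∈ᵇ τ} (proj₁ (proj₂ unique)))
      t∈τ : T (t ∈ᵇ τ)
      t∈τ = ∧-projˡ (proj₁ (proj₂ unique))
      pointwise : ∀ w → w ∈ᵇ τ ≡ (w ∈ᵇ σ ∨ eqF w t)
      pointwise w = T-ext to (λ h → [ σ⊆τ , (λ w≡t → subst (λ x → T (x ∈ᵇ τ)) (sym (eqF⇒≡ w≡t)) t∈τ) ]′
                                       (∨-case {w ∈ᵇ σ} h))
        where
        to : T (w ∈ᵇ τ) → T (w ∈ᵇ σ ∨ eqF w t)
        to w∈τ with T? (w ∈ᵇ σ)
        ... | yes w∈σ = ∨-injˡ w∈σ
        ... | no w∉σ = ∨-injʳ {w ∈ᵇ σ}
                         (fromWitness (proj₂ (proj₂ unique) (∈-allFin w) (∧-intro w∈τ (not-intro w∉σ))))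

    exchange : ∀ {k} {σ τ : Subset n} → ∣ σ ∣ ≡ suc k → ∣ τ ∣ ≡ suc k → ∣ σ ∩ τ ∣ ≡ k →
               ∃₂ λ v t → T (v ∈ᵇ σ) × ¬ T (t ∈ᵇ σ) × τ ≡ swap σ v t
    exchange {k} {σ} {τ} ∣σ∣≡ ∣τ∣≡ ∣σ∩τ∣≡
      with ⊆∧∣∣≡suc⇒insert {σ ∩ τ} {σ} (proj₁ ∘ ∈-∩⁻ σ τ) (trans ∣σ∣≡ (cong suc (sym ∣σ∩τ∣≡)))
         | ⊆∧∣∣≡suc⇒insert {σ ∩ τ} {τ} (proj₂ ∘ ∈-∩⁻ σ τ) (trans ∣τ∣≡ (cong suc (sym ∣σ∩τ∣≡)))
    ... | v , v∉σ∩τ , σ≡ | t , t∉σ∩τ , τ≡ =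
      v , t , v∈σ , t∉σ , trans τ≡ (cong (λ ρ → insert ρ t) σ∩τ≡remove)
      where
      v∈σ : T (v ∈ᵇ σ)
      v∈σ = subst (λ ρ → T (v ∈ᵇ ρ)) (sym σ≡) (t∈insert (σ ∩ τ) v)
      t∉σ : ¬ T (t ∈ᵇ σ)
      t∉σ t∈σ = t∉σ∩τ (∈-∩⁺ σ τ t∈σ (subst (λ ρ → T (t ∈ᵇ ρ)) (sym τ≡) (t∈insert (σ ∩ τ) t)))
      σ∩τ≡remove : σ ∩ τ ≡ remove σ v
      σ∩τ≡remove = tabulate-≗ (σ ∩ τ) _ λ w → T-ext
        (λ w∈σ∩τ → ∧-intro (proj₁ (∈-∩⁻ σ τ w∈σ∩τ))
                           (not-intro λ w≡v → v∉σ∩τ (subst (λ x → T (x ∈ᵇ (σ ∩ τ))) (eqF⇒≡ w≡v) w∈σ∩τ)))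
        (λ h → [ (λ w∈σ∩τ → w∈σ∩τ)
               , (λ w≡v → ⊥-elim (not-elim (∧-projʳ {w ∈ᵇ σ} h) (fromWitness w≡v))) ]′
                 (∈-insert⁻ (σ ∩ τ) v (subst (λ ρ → T (w ∈ᵇ ρ)) σ≡ (∧-projˡ h))))

    ∪-swap : ∀ (σ : Subset n) v t → σ ∪ swap σ v t ≡ insert σ t
    ∪-swap σ v t = tabulate-≗ (σ ∪ swap σ v t) _ λ w →
      trans (∈-∪ σ (swap σ v t) w) (trans (cong (w ∈ᵇ σ ∨_) (∈-swap σ v t w)) (absorb (w ∈ᵇ σ) _ _))
      where
      absorb : ∀ a b c → a ∨ ((a ∧ b) ∨ c) ≡ a ∨ c
      absorb true _ _ = refl
      absorb false _ _ = refl

    ∩-swap : ∀ (σ : Subset n) v t → ¬ T (t ∈ᵇ σ) → σ ∩ swap σ v t ≡ remove σ v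
    ∩-swap σ v t t∉σ = tabulate-≗ (σ ∩ swap σ v t) _ λ w → T-ext
      (λ h → let w∈σ , w∈swap = ∈-∩⁻ σ (swap σ v t) h in
        [ (λ w∈σ∖v → w∈σ∖v)
        , (λ w≡t → ⊥-elim (t∉σ (subst (λ x → T (x ∈ᵇ σ)) (eqF⇒≡ w≡t) w∈σ))) ]′
        (∨-case {w ∈ᵇ σ ∧ not (eqF w v)} (subst T (∈-swap σ v t w) w∈swap)))
      (λ h → ∈-∩⁺ σ (swap σ v t) (∧-projˡ h) (subst T (sym (∈-swap σ v t w)) (∨-injˡ h)))

    ∣swap∣ : ∀ (σ : Subset n) {v t} → T (v ∈ᵇ σ) → ¬ T (t ∈ᵇ σ) → ∣ swap σ v t ∣ ≡ ∣ σ ∣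
    ∣swap∣ σ {v} {t} v∈σ t∉σ =
      trans (∣insert∣ (remove σ v) t (t∉σ ∘ proj₁ ∘ ∈-remove⁻ σ v)) (∣remove∣ σ v v∈σ)

    insert-injective : ∀ (σ : Subset n) {t t′} → ¬ T (t ∈ᵇ σ) → insert σ t ≡ insert σ t′ → t ≡ t′
    insert-injective σ {t} {t′} t∉σ eq =
      [ ⊥-elim ∘ t∉σ , (λ t≡t′ → t≡t′) ]′
        (∈-insert⁻ σ t′ (subst (λ ρ → T (t ∈ᵇ ρ)) eq (t∈insert σ t)))

    swap-injective : ∀ (σ : Subset n) {v v′ t t′} → T (v ∈ᵇ σ) → ¬ T (t ∈ᵇ σ) → ¬ T (t′ ∈ᵇ σ) →
                     swap σ v t ≡ swap σ v′ t′ → v ≡ v′ × t ≡ t′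
    swap-injective σ {v} {v′} {t} {t′} v∈σ t∉σ t′∉σ eq = v≡v′ , t≡t′
      where
      t≡t′ : t ≡ t′
      t≡t′ = [ ⊥-elim ∘ t∉σ ∘ proj₁ ∘ ∈-remove⁻ σ v′ , (λ t≡t′ → t≡t′) ]′
               (∈-insert⁻ (remove σ v′) t′ (subst (λ ρ → T (t ∈ᵇ ρ)) eq (t∈insert (remove σ v) t)))
      v≡v′ : v ≡ v′
      v≡v′ with v Fin.≟ v′
      ... | yes v≡v′ = v≡v′
      ... | no v≢v′ = [ (λ v∈σ∖v → ⊥-elim (proj₂ (∈-remove⁻ σ v v∈σ∖v) refl))
                      , (λ v≡t → ⊥-elim (t∉σ (subst (λ x → T (x ∈ᵇ σ)) v≡t v∈σ))) ]′
                      (∈-insert⁻ (remove σ v) t (subst (λ ρ → T (v ∈ᵇ ρ)) (sym eq)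
                        (∈-insert⁺ (remove σ v′) t′ (∈-remove⁺ σ v′ v∈σ v≢v′))))

  T-does⇒ : ∀ {A : Set} (d : Dec A) → T (does d) → A
  T-does⇒ (yes a) _ = a

  T-does⇐ : ∀ {A : Set} (d : Dec A) → A → T (does d)
  T-does⇐ (yes _) _ = tt
  T-does⇐ (no ¬a) a = ¬a a

  _≟ᵥ_ : ∀ {m} → DecidableEquality (Vec Bool m)
  _≟ᵥ_ = ≡-dec Bool._≟_

  count-allVecs-suc : ∀ {m} (P : Vec Bool (suc m) → Bool) →
    count P (allVecs (suc m)) ≡ count (P ∘ (true ∷_)) (allVecs m) + count (P ∘ (false ∷_)) (allVecs m)
  count-allVecs-suc {m} P = go (allVecs m)
    where
    go : ∀ vs → count P (concatMap (λ v → (true ∷ v) ∷ (false ∷ v) ∷ []) vs) ≡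
                count (P ∘ (true ∷_)) vs + count (P ∘ (false ∷_)) vs
    go [] = refl
    go (v ∷ vs) with P (true ∷ v) | P (false ∷ v)
    ... | true | true = cong suc (trans (cong suc (go vs)) (sym (ℕ.+-suc _ _)))
    ... | true | false = cong suc (go vs)
    ... | false | true = trans (cong suc (go vs)) (sym (ℕ.+-suc _ _))
    ... | false | false = go vs

  -- does rather than ⌊_⌋: does ((b ∷ u) ≟ᵥ (b ∷ v)) computes to does (u ≟ᵥ v).
  count-≟ᵥ : ∀ {m} (v : Vec Bool m) → count (λ u → does (u ≟ᵥ v)) (allVecs m) ≡ 1
  count-≟ᵥ [] = refl
  count-≟ᵥ {suc m} (true ∷ v) = begin
    count (λ u → does (u ≟ᵥ (true ∷ v))) (allVecs (suc m))
      ≡⟨ count-allVecs-suc (λ u → does (u ≟ᵥ (true ∷ v))) ⟩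
    count (λ u → does (u ≟ᵥ v)) (allVecs m) + count (λ _ → false) (allVecs m)
      ≡⟨ cong₂ _+_ (count-≟ᵥ v) (count≡0 (λ _ → false) {allVecs m} (λ _ ())) ⟩
    1 ∎
    where open ≡-Reasoning
  count-≟ᵥ {suc m} (false ∷ v) = begin
    count (λ u → does (u ≟ᵥ (false ∷ v))) (allVecs (suc m))
      ≡⟨ count-allVecs-suc (λ u → does (u ≟ᵥ (false ∷ v))) ⟩
    count (λ _ → false) (allVecs m) + count (λ u → does (u ≟ᵥ v)) (allVecs m)
      ≡⟨ cong₂ _+_ (count≡0 (λ _ → false) {allVecs m} (λ _ ())) (count-≟ᵥ v) ⟩
    1 ∎
    where open ≡-Reasoning

  count-∧-≟ᵥ : ∀ {m} (b : Bool) (v : Vec Bool m) →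
               count (λ u → b ∧ does (u ≟ᵥ v)) (allVecs m) ≡ (if b then 1 else 0)
  count-∧-≟ᵥ true v = count-≟ᵥ v
  count-∧-≟ᵥ {m} false v = count≡0 (λ _ → false) {allVecs m} (λ _ ())

  pairs-∈⁻ : ∀ {n} {i j : Fin n} → (i , j) ∈ pairs n → toℕ i < toℕ j
  pairs-∈⁻ {n} {i} {j} ij∈ = go (allFin n) (∈-concatMap⁻ _ {xs = allFin n} ij∈)
    where
    go : ∀ xs → Any (λ a → (i , j) ∈ List.map (a ,_) (filter (a Fin.<?_) (allFin n))) xs → toℕ i < toℕ j
    go (a ∷ _) (here ij∈a) with ∈-map⁻ _ ij∈a
    ... | b , b∈ , refl = proj₂ (∈-filter⁻ (a Fin.<?_) {xs = allFin n} b∈)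
    go (_ ∷ xs) (there ij∈) = go xs ij∈

  pairs-∈⁺ : ∀ {n} {i j : Fin n} → toℕ i < toℕ j → (i , j) ∈ pairs n
  pairs-∈⁺ {n} {i} {j} i<j = ∈-concatMap⁺ _ {xs = allFin n} (go (allFin n) (∈-allFin i))
    where
    go : ∀ xs → i ∈ xs → Any (λ a → (i , j) ∈ List.map (a ,_) (filter (a Fin.<?_) (allFin n))) xs
    go (a ∷ _) (here refl) = here (∈-map⁺ (a ,_) (∈-filter⁺ (a Fin.<?_) (∈-allFin j) i<j))
    go (_ ∷ xs) (there i∈) = there (go xs i∈)

  joins : ∀ {n} → Fin n → Fin n → Fin n × Fin n → Bool
  joins i j (u , v) = (eqF i u ∧ eqF j v) ∨ (eqF i v ∧ eqF j u)

  joins⁻ : ∀ {n} {i j u v : Fin n} → T (joins i j (u , v)) → (u ≡ i × v ≡ j) ⊎ (u ≡ j × v ≡ i)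
  joins⁻ {i = i} {j} {u} {v} h with ∨-case {eqF i u ∧ eqF j v} h
  ... | inj₁ ij = inj₁ (sym (eqF⇒≡ (∧-projˡ ij)) , sym (eqF⇒≡ (∧-projʳ {eqF i u} ij)))
  ... | inj₂ ji = inj₂ (sym (eqF⇒≡ (∧-projʳ {eqF i v} ji)) , sym (eqF⇒≡ (∧-projˡ ji)))

  joins-injectiveʳ : ∀ {n} {t w w′ : Fin n} e → T (joins t w e) → T (joins t w′ e) → w ≡ w′
  joins-injectiveʳ {t = t} {w} {w′} (u , v) h h′ with joins⁻ {i = t} {w} {u} {v} h | joins⁻ {i = t} {w′} {u} {v} h′
  ... | inj₁ (refl , refl) | inj₁ (_ , refl) = refl
  ... | inj₁ (refl , refl) | inj₂ (refl , refl) = refl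
  ... | inj₂ (refl , refl) | inj₁ (refl , refl) = refl
  ... | inj₂ (refl , _) | inj₂ (refl , _) = refl

  joins-sym : ∀ {n} (i j : Fin n) e → joins i j e ≡ joins j i e
  joins-sym i j (u , v) = trans (∨-comm (eqF i u ∧ eqF j v) (eqF i v ∧ eqF j u))
                            (cong₂ _∨_ (∧-comm (eqF i v) (eqF j u)) (∧-comm (eqF i u) (eqF j v)))

  hasEdge : ∀ {n} (M : Fin n × Fin n → Bool) (es : List (Fin n × Fin n)) → Vec Bool (length es) → Bool
  hasEdge M es G = anyB (λ (b , e) → b ∧ M e) (zipEdges es G)

  pairs-unique : ∀ n → Unique (pairs n)
  pairs-unique n = concat⁺ (AllP.map⁺ (All.tabulate (λ {i} _ → map⁺ (cong proj₂) (filter⁺ (i Fin.<?_) (allFin⁺ n)))))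
                           (AllPairs.map⁺ (AllPairs.map disjoint (allFin⁺ n)))
    where
    open import Data.List.Relation.Unary.Unique.Propositional.Properties using (concat⁺; map⁺; filter⁺)
    import Data.List.Relation.Unary.All.Properties as AllP
    import Data.List.Relation.Unary.AllPairs as AllPairs
    import Data.List.Relation.Unary.AllPairs.Properties as AllPairs
    disjoint : ∀ {i i′} → i ≢ i′ → ∀ {e} → ¬ (e ∈ List.map (i ,_) (filter (i Fin.<?_) (allFin n))
                                               × e ∈ List.map (i′ ,_) (filter (i′ Fin.<?_) (allFin n)))
    disjoint i≢i′ (e∈ , e∈′) with ∈-map⁻ _ e∈ | ∈-map⁻ _ e∈′
    ... | _ , _ , refl | _ , _ , refl = i≢i′ refl

  joins-count< : ∀ {n} {i j : Fin n} → toℕ i < toℕ j → count (joins i j) (pairs n) ≡ 1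
  joins-count< {n} {i} {j} i<j =
    count≡1 _ (pairs-unique n) (pairs-∈⁺ i<j) (∨-injˡ (∧-intro (eqF-refl i) (eqF-refl j))) only
    where
    only : ∀ {e} → e ∈ pairs n → T (joins i j e) → e ≡ (i , j)
    only {u , v} e∈ h with ∨-case {eqF i u ∧ eqF j v} h
    ... | inj₁ ij = cong₂ _,_ (sym (eqF⇒≡ (∧-projˡ ij))) (sym (eqF⇒≡ (∧-projʳ {eqF i u} ij)))
    ... | inj₂ ji with eqF⇒≡ {i = i} {v} (∧-projˡ ji) | eqF⇒≡ {i = j} {u} (∧-projʳ {eqF i v} ji)
    ... | refl | refl = ⊥-elim (ℕ.<-asym i<j (pairs-∈⁻ e∈))

  joins-count : ∀ {n} {i j : Fin n} → i ≢ j → count (joins i j) (pairs n) ≡ 1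
  joins-count {n} {i} {j} i≢j with ℕ.<-cmp (toℕ i) (toℕ j)
  ... | tri< i<j _ _ = joins-count< i<j
  ... | tri≈ _ i≡j _ = ⊥-elim (i≢j (Fin.toℕ-injective i≡j))
  ... | tri> _ _ j<i = trans (count-cong (joins-sym i j) (pairs n)) (joins-count< j<i)

  module _ {n : ℕ} (G : Graph n) where

    adj-sym : ∀ i j → adj {n} G i j ≡ adj {n} G j i
    adj-sym i j = anyB-cong (λ (b , e) → cong (b ∧_) (joins-sym i j e)) (zipEdges (pairs n) G)

    Complete : Subset n → Set
    Complete τ = ∀ {i j} → i ≢ j → T (i ∈ᵇ τ) → T (j ∈ᵇ τ) → T (adj {n} G i j)

    isClique⇒adj< : ∀ τ → T (isClique {n} G τ) →
                    ∀ {i j} → toℕ i < toℕ j → T (i ∈ᵇ τ) → T (j ∈ᵇ τ) → T (adj {n} G i j)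
    isClique⇒adj< τ cl i<j i∈τ j∈τ = [ (λ h → ⊥-elim (not-elim h (∧-intro i∈τ j∈τ))) , (λ a → a) ]′
                                     (∨-case (allB⇒∀ _ cl (pairs-∈⁺ i<j)))

    isClique⇒Complete : ∀ τ → T (isClique {n} G τ) → Complete τ
    isClique⇒Complete τ cl {i} {j} i≢j i∈τ j∈τ with ℕ.<-cmp (toℕ i) (toℕ j)
    ... | tri< i<j _ _ = isClique⇒adj< τ cl i<j i∈τ j∈τ
    ... | tri≈ _ i≡j _ = ⊥-elim (i≢j (Fin.toℕ-injective i≡j))
    ... | tri> _ _ j<i = subst T (adj-sym j i) (isClique⇒adj< τ cl j<i j∈τ i∈τ)

    Complete⇒isClique : ∀ τ → Complete τ → T (isClique {n} G τ)
    Complete⇒isClique τ complete = ∀⇒allB _ (pairs n) λ {(i , j)} ij∈ → edge i j ij∈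
      where
      edge : ∀ i j → (i , j) ∈ pairs n → T (not (i ∈ᵇ τ ∧ j ∈ᵇ τ) ∨ adj {n} G i j)
      edge i j ij∈ with T? (i ∈ᵇ τ ∧ j ∈ᵇ τ)
      ... | yes both = ∨-injʳ {not (i ∈ᵇ τ ∧ j ∈ᵇ τ)}
                         (complete (λ { refl → ℕ.<-irrefl refl (pairs-∈⁻ ij∈) })
                                   (∧-projˡ both) (∧-projʳ {i ∈ᵇ τ} both))
      ... | no ¬both = ∨-injˡ (not-intro ¬both)

    Complete-⊆ : ∀ σ τ → σ ⊆ᵗ τ → Complete τ → Complete σ
    Complete-⊆ σ τ σ⊆τ complete i≢j i∈σ j∈σ = complete i≢j (σ⊆τ i∈σ) (σ⊆τ j∈σ)

    Complete-insert : ∀ σ t → Complete σ → (∀ {w} → T (w ∈ᵇ σ) → w ≢ t → T (adj {n} G t w)) →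
                      Complete (insert σ t)
    Complete-insert σ t complete t~σ {i} {j} i≢j i∈ j∈
      with ∈-insert⁻ σ t i∈ | ∈-insert⁻ σ t j∈
    ... | inj₁ i∈σ | inj₁ j∈σ = complete i≢j i∈σ j∈σ
    ... | inj₁ i∈σ | inj₂ refl = subst T (adj-sym j i) (t~σ i∈σ i≢j)
    ... | inj₂ refl | inj₁ j∈σ = t~σ j∈σ (i≢j ∘ sym)
    ... | inj₂ refl | inj₂ refl = ⊥-elim (i≢j refl)

  -- The neighbourhood of σ in the k-simplex graph

  module _ {n : ℕ} (G : Graph n) (σ : Subset n) where

    adjAll : Fin n → Bool
    adjAll t = not (t ∈ᵇ σ) ∧ allB (λ w → not (w ∈ᵇ σ) ∨ adj G t w) (allFin n)

    adjAllBut : Fin n → Fin n → Bool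
    adjAllBut t v = not (t ∈ᵇ σ) ∧ v ∈ᵇ σ
                  ∧ allB (λ w → not (w ∈ᵇ σ) ∨ eqF w v ∨ adj G t w) (allFin n) ∧ not (adj G t v)

    record AdjAll (t : Fin n) : Set where
      field
        outside : ¬ T (t ∈ᵇ σ)
        adjacent : ∀ {w} → T (w ∈ᵇ σ) → T (adj G t w)

    record AdjAllBut (t v : Fin n) : Set where
      field
        outside : ¬ T (t ∈ᵇ σ)
        excepted : T (v ∈ᵇ σ)
        adjacent : ∀ {w} → T (w ∈ᵇ σ) → w ≢ v → T (adj G t w)
        non-adjacent : ¬ T (adj G t v)

    adjAll⁻ : ∀ {t} → T (adjAll t) → AdjAll t
    adjAll⁻ {t} h = record
      { outside = not-elim (∧-projˡ h)
      ; adjacent = λ {w} w∈σ → [ (λ w∉σ → ⊥-elim (not-elim w∉σ w∈σ)) , (λ a → a) ]′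
                                 (∨-case (allB⇒∀ _ (∧-projʳ {not (t ∈ᵇ σ)} h) (∈-allFin w)))
      }

    adjAll⁺ : ∀ {t} → AdjAll t → T (adjAll t)
    adjAll⁺ {t} a = ∧-intro (not-intro outside) (∀⇒allB _ (allFin n) λ {w} _ → neighbour w)
      where
      open AdjAll a
      neighbour : ∀ w → T (not (w ∈ᵇ σ) ∨ adj G t w)
      neighbour w with T? (w ∈ᵇ σ)
      ... | yes w∈σ = ∨-injʳ {not (w ∈ᵇ σ)} (adjacent w∈σ)
      ... | no w∉σ = ∨-injˡ (not-intro w∉σ)

    adjAllBut⁻ : ∀ {t v} → T (adjAllBut t v) → AdjAllBut t v
    adjAllBut⁻ {t} {v} h = record
      { outside = not-elim (∧-projˡ h)
      ; excepted = ∧-projˡ h₁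
      ; adjacent = λ {w} w∈σ w≢v → [ (λ w∉σ → ⊥-elim (not-elim w∉σ w∈σ)) ,
                                     (λ h′ → [ (λ w≡v → ⊥-elim (w≢v (eqF⇒≡ w≡v))) , (λ a → a) ]′
                                               (∨-case {eqF w v} h′)) ]′
                                   (∨-case (allB⇒∀ _ (∧-projˡ h₂) (∈-allFin w)))
      ; non-adjacent = not-elim (∧-projʳ {allB _ (allFin n)} h₂)
      }
      where
      h₁ = ∧-projʳ {not (t ∈ᵇ σ)} h
      h₂ = ∧-projʳ {v ∈ᵇ σ} h₁

    adjAllBut⁺ : ∀ {t v} → AdjAllBut t v → T (adjAllBut t v)
    adjAllBut⁺ {t} {v} a =
      ∧-intro (not-intro outside) (∧-intro excepted
        (∧-intro (∀⇒allB _ (allFin n) λ {w} _ → neighbour w) (not-intro non-adjacent)))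
      where
      open AdjAllBut a
      neighbour : ∀ w → T (not (w ∈ᵇ σ) ∨ eqF w v ∨ adj G t w)
      neighbour w with T? (w ∈ᵇ σ) | w Fin.≟ v
      ... | no w∉σ | _ = ∨-injˡ (not-intro w∉σ)
      ... | yes _ | yes _ = ∨-injʳ {not (w ∈ᵇ σ)} tt
      ... | yes w∈σ | no w≢v = ∨-injʳ {not (w ∈ᵇ σ)} (adjacent w∈σ w≢v)

    adjAllBut-functional : ∀ {t v v′} → T (adjAllBut t v) → T (adjAllBut t v′) → v ≡ v′
    adjAllBut-functional {v = v} {v′} h h′ with v Fin.≟ v′
    ... | yes v≡v′ = v≡v′
    ... | no v≢v′ = ⊥-elim (AdjAllBut.non-adjacent a′ (AdjAllBut.adjacent a (AdjAllBut.excepted a′) (v≢v′ ∘ sym)))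
      where
      a = adjAllBut⁻ h
      a′ = adjAllBut⁻ h′

    adjAllBut-adjAll-disjoint : ∀ {t v} → ¬ (T (adjAllBut t v) × T (adjAll t))
    adjAllBut-adjAll-disjoint (h , all) =
      AdjAllBut.non-adjacent a (AdjAll.adjacent (adjAll⁻ all) (AdjAllBut.excepted a))
      where a = adjAllBut⁻ h

  module AroundSimplex {n : ℕ} (G : Graph n) (σ : Subset n) {k : ℕ}
                       (σ-clique : T (isClique G σ)) (∣σ∣≡ : ∣ σ ∣ ≡ suc k) where

    record SimplexNeighbour (τ : Subset n) : Set where
      field
        size : ∣ τ ∣ ≡ suc k
        clique : T (isClique G τ)
        distinct : ¬ T (eqS τ σ)
        intersection : ∣ σ ∩ τ ∣ ≡ k
        not-coface : ¬ T (isClique G (σ ∪ τ))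

    record Coface (τ : Subset n) : Set where
      field
        size : ∣ τ ∣ ≡ suc (suc k)
        clique : T (isClique G τ)
        face : T (σ ⊆ᵇ τ)

    σ-complete : Complete G σ
    σ-complete = isClique⇒Complete G σ σ-clique

    simplexNeighbour⇒swap : ∀ {τ} → SimplexNeighbour τ →
                            ∃₂ λ t v → AdjAllBut G σ t v × τ ≡ swap σ v t
    simplexNeighbour⇒swap {τ} nb
      with exchange {σ = σ} {τ} ∣σ∣≡ (SimplexNeighbour.size nb) (SimplexNeighbour.intersection nb)
    ... | v , t , v∈σ , t∉σ , refl = t , v , record
      { outside = t∉σ
      ; excepted = v∈σ
      ; adjacent = adjacent
      ; non-adjacent = λ t~v → not-coface (subst (λ ρ → T (isClique G ρ)) (sym (∪-swap σ v t))
                         (Complete⇒isClique G (insert σ t) (Complete-insert G σ t σ-complete (adjacent′ t~v))))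
      } , refl
      where
      open SimplexNeighbour nb
      t∈τ : T (t ∈ᵇ swap σ v t)
      t∈τ = t∈insert (remove σ v) t
      adjacent : ∀ {w} → T (w ∈ᵇ σ) → w ≢ v → T (adj G t w)
      adjacent {w} w∈σ w≢v =
        isClique⇒Complete G τ clique (λ t≡w → t∉σ (subst (λ x → T (x ∈ᵇ σ)) (sym t≡w) w∈σ))
          t∈τ (∈-insert⁺ (remove σ v) t (∈-remove⁺ σ v w∈σ w≢v))
      adjacent′ : T (adj G t v) → ∀ {w} → T (w ∈ᵇ σ) → w ≢ t → T (adj G t w)
      adjacent′ t~v {w} w∈σ _ with w Fin.≟ v
      ... | yes refl = t~v
      ... | no w≢v = adjacent w∈σ w≢v

    swap⇒simplexNeighbour : ∀ {t v} → AdjAllBut G σ t v → SimplexNeighbour (swap σ v t)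
    swap⇒simplexNeighbour {t} {v} a = record
      { size = trans (∣swap∣ σ excepted outside) ∣σ∣≡
      ; clique = Complete⇒isClique G (swap σ v t) (Complete-insert G (remove σ v) t
                   (Complete-⊆ G (remove σ v) σ (proj₁ ∘ ∈-remove⁻ σ v) σ-complete)
                   (λ w∈σ∖v _ → let w∈σ , w≢v = ∈-remove⁻ σ v w∈σ∖v in adjacent w∈σ w≢v))
      ; distinct = λ same → outside (⊆ᵇ⇒⊆ᵗ (swap σ v t) σ (∧-projˡ same) t∈swap)
      ; intersection = ℕ.suc-injective (begin
          suc ∣ σ ∩ swap σ v t ∣  ≡⟨ cong (λ ρ → suc ∣ ρ ∣) (∩-swap σ v t outside) ⟩
          suc ∣ remove σ v ∣      ≡⟨ ∣remove∣ σ v excepted ⟩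
          ∣ σ ∣                   ≡⟨ ∣σ∣≡ ⟩
          suc k                   ∎)
      ; not-coface = λ cl → non-adjacent
          (isClique⇒Complete G (σ ∪ swap σ v t) cl (λ t≡v → outside (subst (λ x → T (x ∈ᵇ σ)) (sym t≡v) excepted))
            (subst (λ ρ → T (t ∈ᵇ ρ)) (sym (∪-swap σ v t)) (t∈insert σ t))
            (subst (λ ρ → T (v ∈ᵇ ρ)) (sym (∪-swap σ v t)) (∈-insert⁺ σ t excepted)))
      }
      where
      open AdjAllBut a
      open ≡-Reasoning
      t∈swap : T (t ∈ᵇ swap σ v t)
      t∈swap = t∈insert (remove σ v) t

    coface⇒insert : ∀ {τ} → Coface τ → ∃ λ t → AdjAll G σ t × τ ≡ insert σ t
    coface⇒insert {τ} cf
      with ⊆∧∣∣≡suc⇒insert {σ = σ} {τ} (⊆ᵇ⇒⊆ᵗ σ τ (Coface.face cf)) (trans (Coface.size cf) (cong suc (sym ∣σ∣≡)))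
    ... | t , t∉σ , refl = t , record
      { outside = t∉σ
      ; adjacent = λ w∈σ → isClique⇒Complete G τ clique
                             (λ t≡w → t∉σ (subst (λ x → T (x ∈ᵇ σ)) (sym t≡w) w∈σ))
                             (t∈insert σ t) (∈-insert⁺ σ t w∈σ)
      } , refl
      where open Coface cf

    insert⇒coface : ∀ {t} → AdjAll G σ t → Coface (insert σ t)
    insert⇒coface {t} a = record
      { size = trans (∣insert∣ σ t outside) (cong suc ∣σ∣≡)
      ; clique = Complete⇒isClique G (insert σ t) (Complete-insert G σ t σ-complete (λ w∈σ _ → adjacent w∈σ))
      ; face = ⊆ᵗ⇒⊆ᵇ σ (insert σ t) (∈-insert⁺ σ t)
      }
      where open AdjAll a

    isSimplexNeighbour : Subset n → Bool
    isSimplexNeighbour τ = isSimplex k G τ ∧ not (eqS τ σ) ∧ ⌊ ∣ σ ∩ τ ∣ ℕ.≟ k ⌋ ∧ not (isClique G (σ ∪ τ))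

    isCoface : Subset n → Bool
    isCoface τ = isSimplex (suc k) G τ ∧ (σ ⊆ᵇ τ)

    isSimplexNeighbour⁻ : ∀ τ → T (isSimplexNeighbour τ) → SimplexNeighbour τ
    isSimplexNeighbour⁻ τ h = record
      { size = toWitness (∧-projˡ {⌊ ∣ τ ∣ ℕ.≟ suc k ⌋} (∧-projˡ {isSimplex k G τ} h))
      ; clique = ∧-projʳ {⌊ ∣ τ ∣ ℕ.≟ suc k ⌋} (∧-projˡ {isSimplex k G τ} h)
      ; distinct = not-elim (∧-projˡ {not (eqS τ σ)} h₁)
      ; intersection = toWitness (∧-projˡ {⌊ ∣ σ ∩ τ ∣ ℕ.≟ k ⌋} h₂)
      ; not-coface = not-elim (∧-projʳ {⌊ ∣ σ ∩ τ ∣ ℕ.≟ k ⌋} h₂)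
      }
      where
      h₁ : T (not (eqS τ σ) ∧ ⌊ ∣ σ ∩ τ ∣ ℕ.≟ k ⌋ ∧ not (isClique G (σ ∪ τ)))
      h₁ = ∧-projʳ {isSimplex k G τ} h
      h₂ : T (⌊ ∣ σ ∩ τ ∣ ℕ.≟ k ⌋ ∧ not (isClique G (σ ∪ τ)))
      h₂ = ∧-projʳ {not (eqS τ σ)} h₁

    isSimplexNeighbour⁺ : ∀ τ → SimplexNeighbour τ → T (isSimplexNeighbour τ)
    isSimplexNeighbour⁺ τ nb =
      ∧-intro {isSimplex k G τ} (∧-intro {⌊ ∣ τ ∣ ℕ.≟ suc k ⌋} (fromWitness size) clique)
        (∧-intro {not (eqS τ σ)} (not-intro distinct)
          (∧-intro {⌊ ∣ σ ∩ τ ∣ ℕ.≟ k ⌋} (fromWitness intersection) (not-intro not-coface)))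
      where open SimplexNeighbour nb

    isCoface⁻ : ∀ τ → T (isCoface τ) → Coface τ
    isCoface⁻ τ h = record
      { size = toWitness (∧-projˡ {⌊ ∣ τ ∣ ℕ.≟ suc (suc k) ⌋} (∧-projˡ {isSimplex (suc k) G τ} h))
      ; clique = ∧-projʳ {⌊ ∣ τ ∣ ℕ.≟ suc (suc k) ⌋} (∧-projˡ {isSimplex (suc k) G τ} h)
      ; face = ∧-projʳ {isSimplex (suc k) G τ} h
      }

    isCoface⁺ : ∀ τ → Coface τ → T (isCoface τ)
    isCoface⁺ τ cf =
      ∧-intro {isSimplex (suc k) G τ} (∧-intro {⌊ ∣ τ ∣ ℕ.≟ suc (suc k) ⌋} (fromWitness size) clique) face
      where open Coface cf

    viaSwap : Fin n → Fin n → Subset n → Bool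
    viaSwap t v τ = adjAllBut G σ t v ∧ does (τ ≟ᵥ swap σ v t)

    viaInsert : Fin n → Subset n → Bool
    viaInsert t τ = adjAll G σ t ∧ does (τ ≟ᵥ insert σ t)

    viaSwap⁻ : ∀ {t v τ} → T (viaSwap t v τ) → AdjAllBut G σ t v × τ ≡ swap σ v t
    viaSwap⁻ {t} {v} {τ} h = adjAllBut⁻ G σ (∧-projˡ h) , T-does⇒ (τ ≟ᵥ swap σ v t) (∧-projʳ {adjAllBut G σ t v} h)

    viaInsert⁻ : ∀ {t τ} → T (viaInsert t τ) → AdjAll G σ t × τ ≡ insert σ t
    viaInsert⁻ {t} {τ} h = adjAll⁻ G σ (∧-projˡ h) , T-does⇒ (τ ≟ᵥ insert σ t) (∧-projʳ {adjAll G σ t} h)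

    isSimplexNeighbour≡anyB : ∀ τ →
      isSimplexNeighbour τ ≡ anyB (λ t → anyB (λ v → viaSwap t v τ) (allFin n)) (allFin n)
    isSimplexNeighbour≡anyB τ = T-ext to from
      where
      to : T (isSimplexNeighbour τ) → T (anyB (λ t → anyB (λ v → viaSwap t v τ) (allFin n)) (allFin n))
      to h with simplexNeighbour⇒swap (isSimplexNeighbour⁻ τ h)
      ... | t , v , a , τ≡ = ∃⇒anyB _ (∈-allFin t) (∃⇒anyB _ (∈-allFin v)
                               (∧-intro (adjAllBut⁺ G σ a) (T-does⇐ (τ ≟ᵥ swap σ v t) τ≡)))
      from : T (anyB (λ t → anyB (λ v → viaSwap t v τ) (allFin n)) (allFin n)) → T (isSimplexNeighbour τ)
      from h with anyB⇒∃ _ (allFin n) h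
      ... | t , _ , h′ with anyB⇒∃ _ (allFin n) h′
      ... | v , _ , h″ with viaSwap⁻ {t} {v} {τ} h″
      ... | a , refl = isSimplexNeighbour⁺ τ (swap⇒simplexNeighbour a)

    isCoface≡anyB : ∀ τ → isCoface τ ≡ anyB (λ t → viaInsert t τ) (allFin n)
    isCoface≡anyB τ = T-ext to from
      where
      to : T (isCoface τ) → T (anyB (λ t → viaInsert t τ) (allFin n))
      to h with coface⇒insert (isCoface⁻ τ h)
      ... | t , a , τ≡ = ∃⇒anyB _ (∈-allFin t) (∧-intro (adjAll⁺ G σ a) (T-does⇐ (τ ≟ᵥ insert σ t) τ≡))
      from : T (anyB (λ t → viaInsert t τ) (allFin n)) → T (isCoface τ)
      from h with anyB⇒∃ _ (allFin n) h
      ... | t , _ , h′ with viaInsert⁻ {t} {τ} h′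
      ... | a , refl = isCoface⁺ τ (insert⇒coface a)

    degS≡sum : degS k G σ ≡ sum (map (λ t → countFin (adjAllBut G σ t)) (allFin n))
    degS≡sum = begin
      degS k G σ
        ≡⟨ count-cong isSimplexNeighbour≡anyB (allVecs n) ⟩
      count (λ τ → anyB (λ t → anyB (λ v → viaSwap t v τ) (allFin n)) (allFin n)) (allVecs n)
        ≡⟨ count-anyB (λ t τ → anyB (λ v → viaSwap t v τ) (allFin n)) (allFin n) (allFin⁺ n)
                      (λ {t} {t′} {τ} → same-t {t} {t′} {τ}) (allVecs n) ⟩
      sum (map (λ t → count (λ τ → anyB (λ v → viaSwap t v τ) (allFin n)) (allVecs n)) (allFin n))
        ≡⟨ cong sum (map-cong per-t (allFin n)) ⟩
      sum (map (λ t → countFin (adjAllBut G σ t)) (allFin n)) ∎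
      where
      open ≡-Reasoning
      swap-injective′ : ∀ {t t′ v v′ τ} → T (viaSwap t v τ) → T (viaSwap t′ v′ τ) → v ≡ v′ × t ≡ t′
      swap-injective′ {t} {t′} {v} {v′} {τ} h h′ with viaSwap⁻ {t} {v} {τ} h | viaSwap⁻ {t′} {v′} {τ} h′
      ... | a , eq | a′ , eq′ = swap-injective σ (AdjAllBut.excepted a) (AdjAllBut.outside a)
                                  (AdjAllBut.outside a′) (trans (sym eq) eq′)
      same-t : ∀ {t t′ τ} → t ∈ allFin n → t′ ∈ allFin n → T (anyB (λ v → viaSwap t v τ) (allFin n)) →
               T (anyB (λ v → viaSwap t′ v τ) (allFin n)) → t ≡ t′
      same-t {t} {t′} {τ} _ _ h h′ with anyB⇒∃ _ (allFin n) h | anyB⇒∃ _ (allFin n) h′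
      ... | v , _ , hv | v′ , _ , hv′ = proj₂ (swap-injective′ {t} {t′} {v} {v′} {τ} hv hv′)
      per-t : ∀ t → count (λ τ → anyB (λ v → viaSwap t v τ) (allFin n)) (allVecs n) ≡ countFin (adjAllBut G σ t)
      per-t t = begin
        count (λ τ → anyB (λ v → viaSwap t v τ) (allFin n)) (allVecs n)
          ≡⟨ count-anyB (λ v τ → viaSwap t v τ) (allFin n) (allFin⁺ n)
               (λ {v} {v′} {τ} _ _ h h′ → proj₁ (swap-injective′ {t} {t} {v} {v′} {τ} h h′)) (allVecs n) ⟩
        sum (map (λ v → count (viaSwap t v) (allVecs n)) (allFin n))
          ≡⟨ cong sum (map-cong (λ v → count-∧-≟ᵥ (adjAllBut G σ t v) (swap σ v t)) (allFin n)) ⟩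
        sum (map (λ v → if adjAllBut G σ t v then 1 else 0) (allFin n))
          ≡⟨ sym (count≡sum (adjAllBut G σ t) (allFin n)) ⟩
        countFin (adjAllBut G σ t) ∎

    dUp≡sum : dUp k G σ ≡ sum (map (λ t → if adjAll G σ t then 1 else 0) (allFin n))
    dUp≡sum = begin
      dUp k G σ
        ≡⟨ count-cong isCoface≡anyB (allVecs n) ⟩
      count (λ τ → anyB (λ t → viaInsert t τ) (allFin n)) (allVecs n)
        ≡⟨ count-anyB viaInsert (allFin n) (allFin⁺ n) (λ {t} {t′} {τ} → same-t {t} {t′} {τ}) (allVecs n) ⟩
      sum (map (λ t → count (viaInsert t) (allVecs n)) (allFin n))
        ≡⟨ cong sum (map-cong (λ t → count-∧-≟ᵥ (adjAll G σ t) (insert σ t)) (allFin n)) ⟩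
      sum (map (λ t → if adjAll G σ t then 1 else 0) (allFin n)) ∎
      where
      open ≡-Reasoning
      same-t : ∀ {t t′ τ} → t ∈ allFin n → t′ ∈ allFin n → T (viaInsert t τ) → T (viaInsert t′ τ) → t ≡ t′
      same-t {t} {t′} {τ} _ _ h h′ with viaInsert⁻ {t} {τ} h | viaInsert⁻ {t′} {τ} h′
      ... | a , eq | _ , eq′ = insert-injective σ (AdjAll.outside a) (trans (sym eq) eq′)

  -- The paper's X_t (and 0 for t ∈ σ).
  X : ∀ {n} → Subset n → Fin n → Graph n → ℤ
  X σ t G = + countFin (adjAllBut G σ t) - + (if adjAll G σ t then 1 else 0)

  sumOutside-difference : ∀ {n} (σ : Subset n) (a b : Fin n → ℕ) → (∀ {t} → T (t ∈ᵇ σ) → a t ≡ 0 × b t ≡ 0) →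
    sumOutside σ (λ t → + a t - + b t) ≡ + sum (map a (allFin n)) - + sum (map b (allFin n))
  sumOutside-difference {n} σ a b inside≡0 = go (allFin n)
    where
    open +-*-Solver
    difference-+ : ∀ a b A B → (+ a - + b) ℤ.+ (+ A - + B) ≡ + (a + A) - + (b + B)
    difference-+ a b A B rewrite ℤP.pos-+ a A | ℤP.pos-+ b B =
      solve 4 (λ a b A B → (a :- b) :+ (A :- B) := (a :+ A) :- (b :+ B)) refl (+ a) (+ b) (+ A) (+ B)
    go : ∀ ts → foldr (λ t acc → (if t ∈ᵇ σ then + 0 else (+ a t - + b t)) ℤ.+ acc) (+ 0) ts
                ≡ + sum (map a ts) - + sum (map b ts)
    go [] = refl
    go (t ∷ ts) with T? (t ∈ᵇ σ)
    ... | yes t∈σ rewrite T⇒≡true t∈σ | proj₁ (inside≡0 t∈σ) | proj₂ (inside≡0 t∈σ) =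
      trans (ℤP.+-identityˡ _) (go ts)
    ... | no t∉σ rewrite ¬T⇒≡false t∉σ =
      trans (cong (λ s → (+ a t - + b t) ℤ.+ s) (go ts)) (difference-+ (a t) (b t) (sum (map a ts)) (sum (map b ts)))

  degS-dUp≡sumOutside : ∀ {n k} (G : Graph n) (σ : Subset n) → T (isClique G σ) → ∣ σ ∣ ≡ suc k →
                        + degS k G σ - + dUp k G σ ≡ sumOutside σ (λ t → X σ t G)
  degS-dUp≡sumOutside {n} {k} G σ σ-clique ∣σ∣≡ =
    trans (cong₂ (λ d u → + d - + u) degS≡sum dUp≡sum)
          (sym (sumOutside-difference σ (λ t → countFin (adjAllBut G σ t)) (λ t → if adjAll G σ t then 1 else 0)
                                      inside≡0))
    where
    open AroundSimplex G σ σ-clique ∣σ∣≡ using (degS≡sum; dUp≡sum)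
    inside≡0 : ∀ {t} → T (t ∈ᵇ σ) →
               countFin (adjAllBut G σ t) ≡ 0 × (if adjAll G σ t then 1 else 0) ≡ 0
    inside≡0 {t} t∈σ rewrite T⇒≡true t∈σ = count≡0 (λ _ → false) {allFin n} (λ _ ()) , refl

open Combinatorics

module Probability {c ℓ : Level} (R : CommutativeRing c ℓ) (p : CommutativeRing.Carrier R) where

  open CommutativeRing R hiding (_-_)
  open Prob R using (ind; edgeW; natR; powR; qLaw)
  open import Relation.Binary.Reasoning.Setoid setoid
  open NaturalCoefficients commutativeSemiring using (solve; _:+_; _:*_; _:=_; con)

  q : Carrier
  q = 1# + - p

  p+q≈1 : p + q ≈ 1#
  p+q≈1 = begin
    p + (1# + - p)  ≈⟨ +-congˡ (+-comm 1# (- p)) ⟩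
    p + (- p + 1#)  ≈⟨ sym (+-assoc p (- p) 1#) ⟩
    (p + - p) + 1#  ≈⟨ +-congʳ (-‿inverseʳ p) ⟩
    0# + 1#         ≈⟨ +-identityˡ 1# ⟩
    1#              ∎

  p*x+q*x≈x : ∀ x → p * x + q * x ≈ x
  p*x+q*x≈x x = begin
    p * x + q * x  ≈⟨ sym (distribʳ x p q) ⟩
    (p + q) * x    ≈⟨ *-congʳ p+q≈1 ⟩
    1# * x         ≈⟨ *-identityˡ x ⟩
    x              ∎

  a+b≈c⇒b≈c-a : ∀ {a b c} → a + b ≈ c → b ≈ c + - a
  a+b≈c⇒b≈c-a {a} {b} {c} a+b≈c = begin
    b               ≈⟨ sym (+-identityˡ b) ⟩
    0# + b          ≈⟨ +-congʳ (sym (-‿inverseˡ a)) ⟩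
    (- a + a) + b   ≈⟨ +-assoc (- a) a b ⟩
    - a + (a + b)   ≈⟨ +-congˡ a+b≈c ⟩
    - a + c         ≈⟨ +-comm (- a) c ⟩
    c + - a         ∎

  ≈-if : ∀ b {x y z} → (T b → z ≈ x) → (¬ T b → z ≈ y) → z ≈ (if b then x else y)
  ≈-if true z≈x _ = z≈x tt
  ≈-if false _ z≈y = z≈y (λ ())

  module _ {A : Set} where

    ∑ : List A → (A → Carrier) → Carrier
    ∑ xs g = foldr (λ x acc → g x + acc) 0# xs

    ∏ : List A → (A → Carrier) → Carrier
    ∏ xs g = foldr (λ x acc → g x * acc) 1# xs

    ∑-cong : ∀ xs {g h : A → Carrier} → (∀ x → g x ≈ h x) → ∑ xs g ≈ ∑ xs h
    ∑-cong [] _ = refl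
    ∑-cong (x ∷ xs) g≈h = +-cong (g≈h x) (∑-cong xs g≈h)

    ∏-cong : ∀ xs {g h : A → Carrier} → (∀ x → g x ≈ h x) → ∏ xs g ≈ ∏ xs h
    ∏-cong [] _ = refl
    ∏-cong (x ∷ xs) g≈h = *-cong (g≈h x) (∏-cong xs g≈h)

    ∑-+ : ∀ xs (g h : A → Carrier) → ∑ xs (λ x → g x + h x) ≈ ∑ xs g + ∑ xs h
    ∑-+ [] g h = sym (+-identityˡ 0#)
    ∑-+ (x ∷ xs) g h = trans (+-congˡ (∑-+ xs g h))
      (solve 4 (λ a b c d → (a :+ b) :+ (c :+ d) := (a :+ c) :+ (b :+ d)) refl (g x) (h x) (∑ xs g) (∑ xs h))

    ∑-zero : ∀ xs (g : A → Carrier) → (∀ x → g x ≈ 0#) → ∑ xs g ≈ 0#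
    ∑-zero [] g _ = refl
    ∑-zero (x ∷ xs) g g≈0 = trans (+-cong (g≈0 x) (∑-zero xs g g≈0)) (+-identityˡ 0#)

    ∑-if : ∀ xs (f : A → Bool) x → ∑ xs (λ y → if f y then x else 0#) ≈ natR (count f xs) * x
    ∑-if [] f x = sym (zeroˡ x)
    ∑-if (y ∷ xs) f x with f y
    ... | true = trans (+-congˡ (∑-if xs f x))
                   (solve 2 (λ x a → x :+ a :* x := (con 1 :+ a) :* x) refl x (natR (count f xs)))
    ... | false = trans (+-identityˡ _) (∑-if xs f x)

    ∏-if : ∀ xs (f : A → Bool) x → ∏ xs (λ y → if f y then x else 1#) ≈ powR x (count f xs)
    ∏-if [] f x = refl
    ∏-if (y ∷ xs) f x with f y
    ... | true = *-congˡ (∏-if xs f x)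
    ... | false = trans (*-identityˡ _) (∏-if xs f x)

  weight : ∀ {m} → Vec Bool m → Carrier
  weight G = foldr (λ b acc → edgeW p b * acc) 1# (toList G)

  -- Prob.Pr R n p is by definition ℙ (length (pairs n)): the edges of G(n, p) are independent coins.
  ℙ : (m : ℕ) → (Vec Bool m → Bool) → Carrier
  ℙ m E = ∑ (allVecs m) (λ G → weight G * ind (E G))

  ℙ-cong : ∀ m {E E′ : Vec Bool m → Bool} → (∀ G → E G ≡ E′ G) → ℙ m E ≈ ℙ m E′
  ℙ-cong m E≗E′ = ∑-cong (allVecs m) (λ G → *-congˡ (reflexive (≡.cong ind (E≗E′ G))))

  ℙ-∷ : ∀ m (E : Vec Bool (suc m) → Bool) →
        ℙ (suc m) E ≈ p * ℙ m (E ∘ (true ∷_)) + q * ℙ m (E ∘ (false ∷_))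
  ℙ-∷ m E = go (allVecs m)
    where
    go : ∀ Gs → ∑ (concatMap (λ G → (true ∷ G) ∷ (false ∷ G) ∷ []) Gs) (λ G → weight G * ind (E G)) ≈
                p * ∑ Gs (λ G → weight G * ind (E (true ∷ G))) + q * ∑ Gs (λ G → weight G * ind (E (false ∷ G)))
    go [] = solve 2 (λ p q → con 0 := p :* con 0 :+ q :* con 0) refl p q
    go (G ∷ Gs) = trans (+-congˡ (+-congˡ (go Gs)))
      (solve 7 (λ p q w i j S₁ S₂ → (p :* w) :* i :+ ((q :* w) :* j :+ (p :* S₁ :+ q :* S₂))
                                    := p :* (w :* i :+ S₁) :+ q :* (w :* j :+ S₂)) refl
         p q (weight G) (ind (E (true ∷ G))) (ind (E (false ∷ G))) _ _)

  ℙ-true : ∀ m → ℙ m (λ _ → true) ≈ 1#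
  ℙ-true zero = solve 0 (con 1 :* con 1 :+ con 0 := con 1) refl
  ℙ-true (suc m) = trans (ℙ-∷ m (λ _ → true))
                         (trans (+-cong (*-congˡ (ℙ-true m)) (*-congˡ (ℙ-true m))) (p*x+q*x≈x 1#))

  ℙ-false : ∀ m → ℙ m (λ _ → false) ≈ 0#
  ℙ-false m = ∑-zero (allVecs m) _ (λ G → zeroʳ (weight G))

  ℙ-head-free : ∀ m (E : Vec Bool (suc m) → Bool) → (∀ G → E (true ∷ G) ≡ E (false ∷ G)) →
                ℙ (suc m) E ≈ ℙ m (E ∘ (true ∷_))
  ℙ-head-free m E free = begin
    ℙ (suc m) E                                          ≈⟨ ℙ-∷ m E ⟩
    p * ℙ m (E ∘ (true ∷_)) + q * ℙ m (E ∘ (false ∷_))  ≈⟨ +-congˡ (*-congˡ (ℙ-cong m (≡.sym ∘ free))) ⟩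
    p * ℙ m (E ∘ (true ∷_)) + q * ℙ m (E ∘ (true ∷_))   ≈⟨ p*x+q*x≈x _ ⟩
    ℙ m (E ∘ (true ∷_))                                  ∎

  ind-∨ : ∀ a b → ¬ (T a × T b) → ind (a ∨ b) ≈ ind a + ind b
  ind-∨ true true disjoint = ⊥-elim (disjoint (tt , tt))
  ind-∨ true false _ = sym (+-identityʳ 1#)
  ind-∨ false b _ = sym (+-identityˡ (ind b))

  ℙ-∨ : ∀ m (E E′ : Vec Bool m → Bool) → (∀ G → ¬ (T (E G) × T (E′ G))) →
        ℙ m (λ G → E G ∨ E′ G) ≈ ℙ m E + ℙ m E′
  ℙ-∨ m E E′ disjoint = trans
    (∑-cong (allVecs m) (λ G → trans (*-congˡ (ind-∨ (E G) (E′ G) (disjoint G))) (distribˡ (weight G) _ _)))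
    (∑-+ (allVecs m) _ _)

  ℙ-not : ∀ m (E : Vec Bool m → Bool) → ℙ m (not ∘ E) ≈ 1# + - ℙ m E
  ℙ-not m E = a+b≈c⇒b≈c-a (begin
    ℙ m E + ℙ m (not ∘ E)           ≈⟨ sym (ℙ-∨ m E (not ∘ E) (λ G (e , ¬e) → not-elim ¬e e)) ⟩
    ℙ m (λ G → E G ∨ not (E G))     ≈⟨ ℙ-cong m (λ G → excluded-middle (E G)) ⟩
    ℙ m (λ _ → true)                ≈⟨ ℙ-true m ⟩
    1#                              ∎)
    where
    excluded-middle : ∀ b → b ∨ not b ≡ true
    excluded-middle true = ≡.refl
    excluded-middle false = ≡.refl

  ℙ-anyB : ∀ {X : Set} m (E : X → Vec Bool m → Bool) xs → Unique xs →
           (∀ {x y} G → x ∈ xs → y ∈ xs → x ≢ y → ¬ (T (E x G) × T (E y G))) →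
           ℙ m (λ G → anyB (λ x → E x G) xs) ≈ ∑ xs (λ x → ℙ m (E x))
  ℙ-anyB m E [] _ _ = ℙ-false m
  ℙ-anyB m E (x ∷ xs) (x∉ ∷ uniq) disjoint =
    trans (ℙ-∨ m (E x) (λ G → anyB (λ y → E y G) xs) disjoint-head)
          (+-congˡ (ℙ-anyB m E xs uniq (λ G y∈ z∈ → disjoint G (there y∈) (there z∈))))
    where
    disjoint-head : ∀ G → ¬ (T (E x G) × T (anyB (λ y → E y G) xs))
    disjoint-head G (Ex , Exs) with anyB⇒∃ (λ y → E y G) xs Exs
    ... | y , y∈ , Ey = disjoint G (here ≡.refl) (there y∈) (All.lookup x∉ y∈) (Ex , Ey)

  ℙ-[] : (E : Vec Bool 0 → Bool) → ℙ 0 E ≈ ind (E [])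
  ℙ-[] E = trans (+-identityʳ _) (*-identityˡ _)

  ind-∧ : ∀ a b → ind (a ∧ b) ≈ ind a * ind b
  ind-∧ true b = sym (*-identityˡ (ind b))
  ind-∧ false b = sym (zeroˡ (ind b))

  -- Independence of events depending on disjoint sets of coins

  module _ {Ed : Set} where

    Agree : (S : Ed → Bool) (es : List Ed) → Vec Bool (length es) → Vec Bool (length es) → Set
    Agree S [] [] [] = ⊤
    Agree S (e ∷ es) (b ∷ G) (b′ ∷ G′) = (T (S e) → b ≡ b′) × Agree S es G G′

    DependsOn : {B : Set} (S : Ed → Bool) (es : List Ed) → (Vec Bool (length es) → B) → Set
    DependsOn S es f = ∀ G G′ → Agree S es G G′ → f G ≡ f G′

    Disjoint : (S S′ : Ed → Bool) → Set
    Disjoint S S′ = ∀ e → ¬ (T (S e) × T (S′ e))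

    agree-refl : ∀ S es G → Agree S es G G
    agree-refl S [] [] = tt
    agree-refl S (e ∷ es) (b ∷ G) = (λ _ → ≡.refl) , agree-refl S es G

    agree-mono : ∀ {S S′} es → (∀ e → T (S e) → T (S′ e)) → ∀ {G G′} → Agree S′ es G G′ → Agree S es G G′
    agree-mono [] _ {[]} {[]} _ = tt
    agree-mono (e ∷ es) S⊆S′ {_ ∷ _} {_ ∷ _} (same , agree) = same ∘ S⊆S′ e , agree-mono es S⊆S′ agree

    dependsOn-tail : ∀ {B : Set} {S e es} {f : Vec Bool (suc (length es)) → B} →
                     DependsOn S (e ∷ es) f → ∀ b → DependsOn S es (f ∘ (b ∷_))
    dependsOn-tail dep b G G′ agree = dep (b ∷ G) (b ∷ G′) ((λ _ → ≡.refl) , agree)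

    dependsOn-head : ∀ {B : Set} {S e es} {f : Vec Bool (suc (length es)) → B} →
                     DependsOn S (e ∷ es) f → ¬ T (S e) → ∀ G → f (true ∷ G) ≡ f (false ∷ G)
    dependsOn-head {S = S} {es = es} dep ¬Se G = dep (true ∷ G) (false ∷ G) (⊥-elim ∘ ¬Se , agree-refl S es G)

    dependsOn-allB : ∀ {X : Set} (S : X → Ed → Bool) es (F : X → Vec Bool (length es) → Bool) xs →
                     (∀ {x} → x ∈ xs → DependsOn (S x) es (F x)) →
                     DependsOn (λ e → anyB (λ x → S x e) xs) es (λ G → allB (λ x → F x G) xs)
    dependsOn-allB S es F xs dep G G′ agree =
      allB-cong xs λ x∈ → dep x∈ G G′ (agree-mono es (λ e → ∃⇒anyB (λ x → S x e) x∈) agree)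

  ℙ-∧-step : ∀ m (E E′ : Vec Bool (suc m) → Bool) → (∀ G → E′ (true ∷ G) ≡ E′ (false ∷ G)) →
    (∀ b → ℙ m (λ G → E (b ∷ G) ∧ E′ (b ∷ G)) ≈ ℙ m (E ∘ (b ∷_)) * ℙ m (E′ ∘ (b ∷_))) →
    ℙ (suc m) (λ G → E G ∧ E′ G) ≈ ℙ (suc m) E * ℙ (suc m) E′
  ℙ-∧-step m E E′ free split = begin
    ℙ (suc m) (λ G → E G ∧ E′ G)
      ≈⟨ ℙ-∷ m (λ G → E G ∧ E′ G) ⟩
    p * ℙ m (λ G → E (true ∷ G) ∧ E′ (true ∷ G)) + q * ℙ m (λ G → E (false ∷ G) ∧ E′ (false ∷ G))
      ≈⟨ +-cong (*-congˡ (split true)) (*-congˡ (split false)) ⟩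
    p * (ℙ m Eₜ * ℙ m E′ₜ) + q * (ℙ m E_f * ℙ m E′_f)
      ≈⟨ +-congˡ (*-congˡ (*-congˡ (ℙ-cong m (≡.sym ∘ free)))) ⟩
    p * (ℙ m Eₜ * ℙ m E′ₜ) + q * (ℙ m E_f * ℙ m E′ₜ)
      ≈⟨ solve 5 (λ p q a b c → p :* (a :* c) :+ q :* (b :* c) := (p :* a :+ q :* b) :* c) refl p q _ _ _ ⟩
    (p * ℙ m Eₜ + q * ℙ m E_f) * ℙ m E′ₜ
      ≈⟨ *-cong (sym (ℙ-∷ m E)) (sym (ℙ-head-free m E′ free)) ⟩
    ℙ (suc m) E * ℙ (suc m) E′
      ∎
    where
    Eₜ = E ∘ (true ∷_)
    E′ₜ = E′ ∘ (true ∷_)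
    E_f = E ∘ (false ∷_)
    E′_f = E′ ∘ (false ∷_)

  -- Every coin is irrelevant to E or to E′, so ℙ-∧-step splits it off.
  ℙ-∧-independent : ∀ {Ed : Set} es (S S′ : Ed → Bool) → Disjoint S S′ → (E E′ : Vec Bool (length es) → Bool) →
    DependsOn S es E → DependsOn S′ es E′ → ℙ (length es) (λ G → E G ∧ E′ G) ≈ ℙ (length es) E * ℙ (length es) E′
  ℙ-∧-independent [] S S′ _ E E′ _ _ = begin
    ℙ 0 (λ G → E G ∧ E′ G)     ≈⟨ ℙ-[] (λ G → E G ∧ E′ G) ⟩
    ind (E [] ∧ E′ [])         ≈⟨ ind-∧ (E []) (E′ []) ⟩
    ind (E []) * ind (E′ [])   ≈⟨ sym (*-cong (ℙ-[] E) (ℙ-[] E′)) ⟩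
    ℙ 0 E * ℙ 0 E′             ∎
  ℙ-∧-independent (e ∷ es) S S′ disjoint E E′ dep dep′ with T? (S e)
  ... | yes Se = ℙ-∧-step (length es) E E′ (dependsOn-head dep′ (λ S′e → disjoint e (Se , S′e))) split
    where
    split : ∀ b → _
    split b = ℙ-∧-independent es S S′ disjoint _ _ (dependsOn-tail dep b) (dependsOn-tail dep′ b)
  ... | no ¬Se = begin
    ℙ m (λ G → E G ∧ E′ G)   ≈⟨ ℙ-cong m (λ G → ∧-comm (E G) (E′ G)) ⟩
    ℙ m (λ G → E′ G ∧ E G)   ≈⟨ ℙ-∧-step (length es) E′ E (dependsOn-head dep ¬Se) split ⟩
    ℙ m E′ * ℙ m E           ≈⟨ *-comm _ _ ⟩
    ℙ m E * ℙ m E′           ∎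
    where
    m = suc (length es)
    split : ∀ b → _
    split b = trans (ℙ-cong (length es) (λ G → ∧-comm (E′ (b ∷ G)) (E (b ∷ G))))
              (trans (ℙ-∧-independent es S S′ disjoint _ _ (dependsOn-tail dep b) (dependsOn-tail dep′ b))
                     (*-comm _ _))

  ℙ-allB-independent : ∀ {Ed X : Set} es (S : X → Ed → Bool) (F : X → Vec Bool (length es) → Bool) xs → Unique xs →
    (∀ {x} → x ∈ xs → DependsOn (S x) es (F x)) →
    (∀ {x y} → x ∈ xs → y ∈ xs → x ≢ y → Disjoint (S x) (S y)) →
    ℙ (length es) (λ G → allB (λ x → F x G) xs) ≈ ∏ xs (λ x → ℙ (length es) (F x))
  ℙ-allB-independent es S F [] _ _ _ = ℙ-true (length es)
  ℙ-allB-independent es S F (x ∷ xs) (x∉ ∷ uniq) dep disjoint =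
    trans (ℙ-∧-independent es (S x) (λ e → anyB (λ y → S y e) xs) disjoint-rest (F x) _ (dep (here ≡.refl))
             (dependsOn-allB S es F xs (dep ∘ there)))
          (*-congˡ (ℙ-allB-independent es S F xs uniq (dep ∘ there) (λ y∈ z∈ → disjoint (there y∈) (there z∈))))
    where
    disjoint-rest : Disjoint (S x) (λ e → anyB (λ y → S y e) xs)
    disjoint-rest e (Sx , Sxs) with anyB⇒∃ (λ y → S y e) xs Sxs
    ... | y , y∈ , Sy = disjoint (here ≡.refl) (there y∈) (All.lookup x∉ y∈) e (Sx , Sy)

  module _ {n : ℕ} where

    hasEdge-dependsOn : ∀ (M : Fin n × Fin n → Bool) es → DependsOn M es (hasEdge M es)
    hasEdge-dependsOn M [] [] [] _ = ≡.refl
    hasEdge-dependsOn M (e ∷ es) (b ∷ G) (b′ ∷ G′) (same , agree) =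
      ≡.cong₂ _∨_ head (hasEdge-dependsOn M es G G′ agree)
      where
      head : b ∧ M e ≡ b′ ∧ M e
      head with M e in Me
      ... | true = ≡.trans (∧-identityʳ b) (≡.trans (same tt) (≡.sym (∧-identityʳ b′)))
      ... | false = ≡.trans (∧-zeroʳ b) (≡.sym (∧-zeroʳ b′))

    hasEdge-none : ∀ (M : Fin n × Fin n → Bool) es → count M es ≡ 0 → ∀ G → hasEdge M es G ≡ false
    hasEdge-none M [] _ [] = ≡.refl
    hasEdge-none M (e ∷ es) c (b ∷ G) with M e
    ... | true with () ← c
    ... | false = ≡.cong₂ _∨_ (∧-zeroʳ b) (hasEdge-none M es c G)

    ℙ-hasEdge : ∀ (M : Fin n × Fin n → Bool) es → count M es ≡ 1 → ℙ (length es) (hasEdge M es) ≈ p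
    ℙ-hasEdge M (e ∷ es) c with M e in Me
    ... | true = begin
      ℙ (suc m) (hasEdge M (e ∷ es))
        ≈⟨ ℙ-∷ m (hasEdge M (e ∷ es)) ⟩
      p * ℙ m (λ G → (true ∧ M e) ∨ hasEdge M es G) + q * ℙ m (λ G → (false ∧ M e) ∨ hasEdge M es G)
        ≈⟨ +-cong (*-congˡ (trans (ℙ-cong m (λ G → ≡.cong (_∨ hasEdge M es G) Me)) (ℙ-true m)))
                  (*-congˡ (trans (ℙ-cong m (hasEdge-none M es (ℕ.suc-injective c))) (ℙ-false m))) ⟩
      p * 1# + q * 0#
        ≈⟨ solve 2 (λ p q → p :* con 1 :+ q :* con 0 := p) refl p q ⟩
      p ∎
      where m = length es
    ... | false = begin
      ℙ (suc m) (hasEdge M (e ∷ es))        ≈⟨ ℙ-head-free m (hasEdge M (e ∷ es)) M-e-irrelevant ⟩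
      ℙ m (λ G → M e ∨ hasEdge M es G)      ≈⟨ ℙ-cong m M-e-irrelevant ⟩
      ℙ m (hasEdge M es)                    ≈⟨ ℙ-hasEdge M es c ⟩
      p                                     ∎
      where
      m = length es
      M-e-irrelevant : ∀ G → M e ∨ hasEdge M es G ≡ hasEdge M es G
      M-e-irrelevant G = ≡.cong (_∨ hasEdge M es G) Me

  -- The law of X_t

  module AdjacentToAll {n : ℕ} (t : Fin n) (g : Fin n → Bool) where

    adjacentToAll : Graph n → Bool
    adjacentToAll G = allB (λ w → not (g w) ∨ adj G t w) (allFin n)

    edgesToward : Fin n × Fin n → Bool
    edgesToward e = anyB (λ w → g w ∧ joins t w e) (allFin n)

    adjacent-dependsOn : ∀ w → DependsOn (λ e → g w ∧ joins t w e) (pairs n) (λ G → not (g w) ∨ adj G t w)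
    adjacent-dependsOn w G G′ agree = not-∨-congʳ-T (g w) λ gw →
      hasEdge-dependsOn (joins t w) (pairs n) G G′ (agree-mono (pairs n) (λ _ → ∧-intro gw) agree)

    adjacentToAll-dependsOn : DependsOn edgesToward (pairs n) adjacentToAll
    adjacentToAll-dependsOn =
      dependsOn-allB (λ w e → g w ∧ joins t w e) (pairs n) _ (allFin n) (λ {w} _ → adjacent-dependsOn w)

    ℙ-adjacentToAll : (∀ {w} → T (g w) → t ≢ w) → ℙ (length (pairs n)) adjacentToAll ≈ powR p (countFin g)
    ℙ-adjacentToAll t∉g = begin
      ℙ m adjacentToAll
        ≈⟨ ℙ-allB-independent (pairs n) (λ w e → g w ∧ joins t w e) _ (allFin n) (allFin⁺ n)
             (λ {w} _ → adjacent-dependsOn w) disjoint ⟩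
      ∏ (allFin n) (λ w → ℙ m (λ G → not (g w) ∨ adj G t w))
        ≈⟨ ∏-cong (allFin n) each ⟩
      ∏ (allFin n) (λ w → if g w then p else 1#)
        ≈⟨ ∏-if (allFin n) g p ⟩
      powR p (countFin g) ∎
      where
      m = length (pairs n)
      disjoint : ∀ {w w′} → w ∈ allFin n → w′ ∈ allFin n → w ≢ w′ →
                 Disjoint (λ e → g w ∧ joins t w e) (λ e → g w′ ∧ joins t w′ e)
      disjoint {w} {w′} _ _ w≢w′ e (tw , tw′) =
        w≢w′ (joins-injectiveʳ {t = t} e (∧-projʳ {g w} tw) (∧-projʳ {g w′} tw′))
      each : ∀ w → ℙ m (λ G → not (g w) ∨ adj G t w) ≈ (if g w then p else 1#)
      each w with g w in gw
      ... | true = ℙ-hasEdge (joins t w) (pairs n) (joins-count (t∉g (≡true⇒T gw)))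
      ... | false = ℙ-true m

  module OutsideVertex {n : ℕ} {σ : Subset n} {k : ℕ} (∣σ∣≡ : ∣ σ ∣ ≡ suc k)
                       {t : Fin n} (t∉σ : ¬ T (t ∈ᵇ σ)) where

    m : ℕ
    m = length (pairs n)

    t≢σ : ∀ {w} → T (w ∈ᵇ σ) → t ≢ w
    t≢σ w∈σ ≡.refl = t∉σ w∈σ

    ℙ-adjAll : ℙ m (λ G → adjAll G σ t) ≈ powR p (suc k)
    ℙ-adjAll = begin
      ℙ m (λ G → adjAll G σ t)     ≈⟨ ℙ-cong m (λ G → ≡.cong (λ b → not b ∧ adjacentToAll G) (¬T⇒≡false t∉σ)) ⟩
      ℙ m adjacentToAll            ≈⟨ ℙ-adjacentToAll t≢σ ⟩
      powR p (countFin (_∈ᵇ σ))    ≈⟨ reflexive (≡.cong (powR p) (≡.trans (≡.sym (∣∣≡countFin σ)) ∣σ∣≡)) ⟩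
      powR p (suc k)               ∎
      where open AdjacentToAll t (_∈ᵇ σ)

    ℙ-¬adj : ∀ {w} → T (w ∈ᵇ σ) → ℙ m (λ G → not (adj G t w)) ≈ q
    ℙ-¬adj {w} w∈σ = trans (ℙ-not m (λ G → adj G t w))
                           (+-congˡ (-‿cong (ℙ-hasEdge (joins t w) (pairs n) (joins-count (t≢σ w∈σ)))))

    ℙ-adjAllBut : ∀ {v} → T (v ∈ᵇ σ) → ℙ m (λ G → adjAllBut G σ t v) ≈ powR p k * q
    ℙ-adjAllBut {v} v∈σ = begin
      ℙ m (λ G → adjAllBut G σ t v)
        ≈⟨ ℙ-cong m rearrange ⟩
      ℙ m (λ G → adjacentToAll G ∧ not (adj G t v))
        ≈⟨ ℙ-∧-independent (pairs n) edgesToward (joins t v) disjoint _ _ adjacentToAll-dependsOn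
             (λ G G′ → ≡.cong not ∘ hasEdge-dependsOn (joins t v) (pairs n) G G′) ⟩
      ℙ m adjacentToAll * ℙ m (λ G → not (adj G t v))
        ≈⟨ *-cong (ℙ-adjacentToAll (t≢σ ∘ ∧-projˡ)) (ℙ-¬adj v∈σ) ⟩
      powR p (countFin others) * q
        ≈⟨ reflexive (≡.cong (λ i → powR p i * q) ∣others∣≡k) ⟩
      powR p k * q ∎
      where
      others : Fin n → Bool
      others w = w ∈ᵇ σ ∧ not (eqF w v)
      open AdjacentToAll t others
      ∣others∣≡k : countFin others ≡ k
      ∣others∣≡k = ℕ.suc-injective (≡.trans
        (≡.cong suc (≡.trans (count-cong (≡.sym ∘ ∈-remove σ v) (allFin n)) (≡.sym (∣∣≡countFin (remove σ v)))))
        (≡.trans (∣remove∣ σ v v∈σ) ∣σ∣≡))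
      guard : ∀ a b x → not a ∨ b ∨ x ≡ not (a ∧ not b) ∨ x
      guard true true x = ≡.refl
      guard true false x = ≡.refl
      guard false b x = ≡.refl
      rearrange : ∀ G → adjAllBut G σ t v ≡ adjacentToAll G ∧ not (adj G t v)
      rearrange G = ≡.trans
        (≡.cong₂ (λ a b → not a ∧ b ∧ allB (λ w → not (w ∈ᵇ σ) ∨ eqF w v ∨ adj G t w) (allFin n)
                                  ∧ not (adj G t v))
                 (¬T⇒≡false t∉σ) (T⇒≡true v∈σ))
        (≡.cong (_∧ not (adj G t v)) (allB-cong (allFin n) (λ {w} _ → guard (w ∈ᵇ σ) (eqF w v) (adj G t w))))
      disjoint : Disjoint edgesToward (joins t v)
      disjoint e (toward , tv) with anyB⇒∃ _ (allFin n) toward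
      ... | w , _ , h with joins-injectiveʳ {t = t} e (∧-projʳ {others w} h) tv
      ... | ≡.refl = not-elim (∧-projʳ {w ∈ᵇ σ} (∧-projˡ {others w} h)) (eqF-refl w)

    nonNeighbour : Graph n → Bool
    nonNeighbour G = anyB (adjAllBut G σ t) (allFin n)

    ℙ-nonNeighbour : ℙ m nonNeighbour ≈ natR (suc k) * (powR p k * q)
    ℙ-nonNeighbour = begin
      ℙ m nonNeighbour
        ≈⟨ ℙ-anyB m (λ v G → adjAllBut G σ t v) (allFin n) (allFin⁺ n)
             (λ G _ _ v≢v′ (h , h′) → v≢v′ (adjAllBut-functional G σ h h′)) ⟩
      ∑ (allFin n) (λ v → ℙ m (λ G → adjAllBut G σ t v))
        ≈⟨ ∑-cong (allFin n) each ⟩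
      ∑ (allFin n) (λ v → if v ∈ᵇ σ then powR p k * q else 0#)
        ≈⟨ ∑-if (allFin n) (_∈ᵇ σ) _ ⟩
      natR (countFin (_∈ᵇ σ)) * (powR p k * q)
        ≈⟨ reflexive (≡.cong (λ i → natR i * (powR p k * q)) (≡.trans (≡.sym (∣∣≡countFin σ)) ∣σ∣≡)) ⟩
      natR (suc k) * (powR p k * q) ∎
      where
      each : ∀ v → ℙ m (λ G → adjAllBut G σ t v) ≈ (if v ∈ᵇ σ then powR p k * q else 0#)
      each v = ≈-if (v ∈ᵇ σ) ℙ-adjAllBut λ v∉σ → trans (ℙ-cong m (excepted-outside v∉σ)) (ℙ-false m)
        where
        excepted-outside : ¬ T (v ∈ᵇ σ) → ∀ G → adjAllBut G σ t v ≡ false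
        excepted-outside v∉σ G = ≡.trans
          (≡.cong (λ b → not (t ∈ᵇ σ) ∧ b ∧ allB (λ w → not (w ∈ᵇ σ) ∨ eqF w v ∨ adj G t w) (allFin n)
                                         ∧ not (adj G t v))
                  (¬T⇒≡false v∉σ))
          (∧-zeroʳ (not (t ∈ᵇ σ)))

    nonNeighbour-adjAll-disjoint : ∀ G → ¬ (T (nonNeighbour G) × T (adjAll G σ t))
    nonNeighbour-adjAll-disjoint G (some , all) with anyB⇒∃ _ (allFin n) some
    ... | v , _ , h = adjAllBut-adjAll-disjoint G σ (h , all)

    X≡indicators : ∀ G → X σ t G ≡ + (if nonNeighbour G then 1 else 0) - + (if adjAll G σ t then 1 else 0)
    X≡indicators G = ≡.cong (λ i → + i - + (if adjAll G σ t then 1 else 0))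
                  (count≡if-anyB (adjAllBut G σ t) (allFin⁺ n) (λ _ _ → adjAllBut-functional G σ))

    hits : ℤ → Bool → Bool → Bool
    hits (+ 0) y u = not y ∧ not u
    hits (+ 1) y u = y
    hits -[1+ 0 ] y u = u
    hits _ _ _ = false

    value≟≡hits : ∀ a y u → ¬ (T y × T u) → ⌊ + (if y then 1 else 0) - + (if u then 1 else 0) ℤP.≟ a ⌋ ≡ hits a y u
    value≟≡hits a true true both = ⊥-elim (both (tt , tt))
    value≟≡hits (+ 0) true false _ = ≡.refl
    value≟≡hits (+ 1) true false _ = ≡.refl
    value≟≡hits (+ suc (suc _)) true false _ = ≡.refl
    value≟≡hits -[1+ 0 ] true false _ = ≡.refl
    value≟≡hits -[1+ suc _ ] true false _ = ≡.refl
    value≟≡hits (+ 0) false true _ = ≡.refl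
    value≟≡hits (+ 1) false true _ = ≡.refl
    value≟≡hits (+ suc (suc _)) false true _ = ≡.refl
    value≟≡hits -[1+ 0 ] false true _ = ≡.refl
    value≟≡hits -[1+ suc _ ] false true _ = ≡.refl
    value≟≡hits (+ 0) false false _ = ≡.refl
    value≟≡hits (+ 1) false false _ = ≡.refl
    value≟≡hits (+ suc (suc _)) false false _ = ≡.refl
    value≟≡hits -[1+ 0 ] false false _ = ≡.refl
    value≟≡hits -[1+ suc _ ] false false _ = ≡.refl

    ℙ-hits : ∀ a → ℙ m (λ G → hits a (nonNeighbour G) (adjAll G σ t)) ≈ qLaw k p a
    ℙ-hits (+ 0) = begin
      ℙ m (λ G → not (nonNeighbour G) ∧ not (adjAll G σ t))
        ≈⟨ ℙ-cong m (λ G → ≡.sym (deMorgan (nonNeighbour G) (adjAll G σ t))) ⟩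
      ℙ m (λ G → not (nonNeighbour G ∨ adjAll G σ t))
        ≈⟨ ℙ-not m (λ G → nonNeighbour G ∨ adjAll G σ t) ⟩
      1# + - ℙ m (λ G → nonNeighbour G ∨ adjAll G σ t)
        ≈⟨ +-congˡ (-‿cong (ℙ-∨ m nonNeighbour (λ G → adjAll G σ t) nonNeighbour-adjAll-disjoint)) ⟩
      1# + - (ℙ m nonNeighbour + ℙ m (λ G → adjAll G σ t))
        ≈⟨ +-congˡ (-‿cong (+-cong ℙ-nonNeighbour ℙ-adjAll)) ⟩
      1# + - (natR (suc k) * (powR p k * q) + powR p (suc k))
        ≈⟨ +-congˡ (sym (⁻¹-∙-comm _ _)) ⟩
      1# + (- (natR (suc k) * (powR p k * q)) + - powR p (suc k))
        ≈⟨ sym (+-assoc _ _ _) ⟩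
      1# + - (natR (suc k) * (powR p k * q)) + - powR p (suc k)
        ≈⟨ +-congʳ (+-congˡ (-‿cong (*-assoc _ _ _))) ⟨
      qLaw k p (+ 0) ∎
      where
      open import Algebra.Properties.AbelianGroup +-abelianGroup using (⁻¹-∙-comm)
      deMorgan : ∀ a b → not (a ∨ b) ≡ not a ∧ not b
      deMorgan true _ = ≡.refl
      deMorgan false _ = ≡.refl
    ℙ-hits (+ 1) = trans ℙ-nonNeighbour (sym (*-assoc _ _ _))
    ℙ-hits (+ suc (suc _)) = ℙ-false m
    ℙ-hits -[1+ 0 ] = ℙ-adjAll
    ℙ-hits -[1+ suc _ ] = ℙ-false m

    ℙ-X≡ : ∀ a → ℙ m (λ G → ⌊ X σ t G ℤP.≟ a ⌋) ≈ qLaw k p a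
    ℙ-X≡ a = trans (ℙ-cong m (λ G → ≡.trans (≡.cong (λ x → ⌊ x ℤP.≟ a ⌋) (X≡indicators G))
                                       (value≟≡hits a _ _ (nonNeighbour-adjAll-disjoint G))))
                   (ℙ-hits a)

  module _ {n : ℕ} (σ : Subset n) where

    inside : Fin n × Fin n → Bool
    inside (u , v) = u ∈ᵇ σ ∧ v ∈ᵇ σ

    between : Fin n → Fin n × Fin n → Bool
    between t e = not (t ∈ᵇ σ) ∧ AdjacentToAll.edgesToward t (_∈ᵇ σ) e

    isClique-dependsOn : DependsOn inside (pairs n) (λ G → isClique G σ)
    isClique-dependsOn G G′ agree = allB-cong (pairs n) λ { {i , j} _ →
      not-∨-congʳ-T (i ∈ᵇ σ ∧ j ∈ᵇ σ) λ ij∈σ →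
        hasEdge-dependsOn (joins i j) (pairs n) G G′ (agree-mono (pairs n) (joins⇒inside ij∈σ) agree) }
      where
      joins⇒inside : ∀ {i j} → T (i ∈ᵇ σ ∧ j ∈ᵇ σ) → ∀ e → T (joins i j e) → T (inside e)
      joins⇒inside {i} {j} ij∈σ (u , v) h with joins⁻ {i = i} {j} {u} {v} h
      ... | inj₁ (≡.refl , ≡.refl) = ij∈σ
      ... | inj₂ (≡.refl , ≡.refl) = ≡.subst T (∧-comm (i ∈ᵇ σ) (j ∈ᵇ σ)) ij∈σ

    X-dependsOn : ∀ t → DependsOn (AdjacentToAll.edgesToward t (_∈ᵇ σ)) (pairs n) (X σ t)
    X-dependsOn t G G′ agree = ≡.cong₂ (λ i j → + i - + (if j then 1 else 0))
      (count-cong (λ v → ≡.cong (not (t ∈ᵇ σ) ∧_) (∧-congʳ-T (v ∈ᵇ σ) λ v∈σ →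
         ≡.cong₂ _∧_ (allB-cong (allFin n) λ {w} _ → not-∨-congʳ-T (w ∈ᵇ σ) λ w∈σ →
                                                        ≡.cong (eqF w v ∨_) (adj-agree w∈σ))
                     (≡.cong not (adj-agree v∈σ)))) (allFin n))
      (≡.cong (not (t ∈ᵇ σ) ∧_) (adjacentToAll-dependsOn G G′ agree))
      where
      open AdjacentToAll t (_∈ᵇ σ)
      adj-agree : ∀ {w} → T (w ∈ᵇ σ) → adj G t w ≡ adj G′ t w
      adj-agree {w} w∈σ = hasEdge-dependsOn (joins t w) (pairs n) G G′
        (agree-mono (pairs n) (λ e j → ∃⇒anyB (λ w → w ∈ᵇ σ ∧ joins t w e) (∈-allFin w) (∧-intro w∈σ j)) agree)

    between⁻ : ∀ {t u v} → T (between t (u , v)) →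
               ¬ T (t ∈ᵇ σ) × ∃ λ w → T (w ∈ᵇ σ) × ((u ≡ t × v ≡ w) ⊎ (u ≡ w × v ≡ t))
    between⁻ {t} {u} {v} h with anyB⇒∃ _ (allFin n) (∧-projʳ {not (t ∈ᵇ σ)} h)
    ... | w , _ , h′ = not-elim (∧-projˡ h) , w , ∧-projˡ h′ , joins⁻ {i = t} {w} {u} {v} (∧-projʳ {w ∈ᵇ σ} h′)

    inside-between-disjoint : ∀ t → Disjoint inside (between t)
    inside-between-disjoint t (u , v) (u,v∈σ , h) with between⁻ {t} {u} {v} h
    ... | t∉σ , _ , _ , inj₁ (≡.refl , _) = t∉σ (∧-projˡ u,v∈σ)
    ... | t∉σ , _ , _ , inj₂ (_ , ≡.refl) = t∉σ (∧-projʳ {u ∈ᵇ σ} u,v∈σ)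

    between-disjoint : ∀ {t t′} → t ≢ t′ → Disjoint (between t) (between t′)
    between-disjoint {t} {t′} t≢t′ (u , v) (h , h′) with between⁻ {t} {u} {v} h | between⁻ {t′} {u} {v} h′
    ... | _ , _ , _ , inj₁ (≡.refl , _) | _ , _ , _ , inj₁ (≡.refl , _) = t≢t′ ≡.refl
    ... | t∉σ , _ , _ , inj₁ (≡.refl , _) | _ , _ , w′∈σ , inj₂ (≡.refl , _) = t∉σ w′∈σ
    ... | t∉σ , _ , _ , inj₂ (_ , ≡.refl) | _ , _ , w′∈σ , inj₁ (_ , ≡.refl) = t∉σ w′∈σ
    ... | _ , _ , _ , inj₂ (_ , ≡.refl) | _ , _ , _ , inj₂ (_ , ≡.refl) = t≢t′ ≡.refl

    outcome : (Fin n → ℤ) → Fin n → Graph n → Bool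
    outcome a t G = t ∈ᵇ σ ∨ ⌊ X σ t G ℤP.≟ a t ⌋

    outcome-dependsOn : ∀ a t → DependsOn (between t) (pairs n) (outcome a t)
    outcome-dependsOn a t G G′ agree = ∨-congʳ-¬T (t ∈ᵇ σ) λ t∉σ →
      ≡.cong (λ x → ⌊ x ℤP.≟ a t ⌋)
             (X-dependsOn t G G′ (agree-mono (pairs n) (λ _ → ∧-intro (not-intro t∉σ)) agree))

    ℙ-clique∧outcomes : ∀ {k} → ∣ σ ∣ ≡ suc k → ∀ a →
      ℙ (length (pairs n)) (λ G → isClique G σ ∧ allB (λ t → outcome a t G) (allFin n)) ≈
      ℙ (length (pairs n)) (λ G → isClique G σ) * Prob.prodOutside R σ (λ t → qLaw k p (a t))
    ℙ-clique∧outcomes {k} ∣σ∣≡ a = begin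
      ℙ m (λ G → isClique G σ ∧ allB (λ t → outcome a t G) (allFin n))
        ≈⟨ ℙ-∧-independent (pairs n) inside (λ e → anyB (λ t → between t e) (allFin n)) disjoint _ _
             isClique-dependsOn
             (dependsOn-allB between (pairs n) (outcome a) (allFin n) (λ {t} _ → outcome-dependsOn a t)) ⟩
      ℙ m (λ G → isClique G σ) * ℙ m (λ G → allB (λ t → outcome a t G) (allFin n))
        ≈⟨ *-congˡ (ℙ-allB-independent (pairs n) between (outcome a) (allFin n) (allFin⁺ n)
                      (λ {t} _ → outcome-dependsOn a t) (λ _ _ → between-disjoint)) ⟩
      ℙ m (λ G → isClique G σ) * ∏ (allFin n) (λ t → ℙ m (outcome a t))
        ≈⟨ *-congˡ (∏-cong (allFin n) law) ⟩
      ℙ m (λ G → isClique G σ) * Prob.prodOutside R σ (λ t → qLaw k p (a t)) ∎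
      where
      m = length (pairs n)
      disjoint : Disjoint inside (λ e → anyB (λ t → between t e) (allFin n))
      disjoint e (in-σ , some) with anyB⇒∃ _ (allFin n) some
      ... | t , _ , h = inside-between-disjoint t e (in-σ , h)
      law : ∀ t → ℙ m (outcome a t) ≈ (if t ∈ᵇ σ then 1# else qLaw k p (a t))
      law t = ≈-if (t ∈ᵇ σ)
        (λ t∈σ → trans (ℙ-cong m (λ G → ≡.cong (_∨ ⌊ X σ t G ℤP.≟ a t ⌋) (T⇒≡true t∈σ))) (ℙ-true m))
        (λ t∉σ → trans (ℙ-cong m (λ G → ≡.cong (_∨ ⌊ X σ t G ℤP.≟ a t ⌋) (¬T⇒≡false t∉σ)))
                       (OutsideVertex.ℙ-X≡ {n} {σ} {k} ∣σ∣≡ {t} t∉σ (a t)))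
lemma4 : ∀ {c ℓ} (k : ℕ) → 1 ≤ k → (n : ℕ) (σ : Subset n) → ∣ σ ∣ ≡ suc k →
         (R : CommutativeRing c ℓ) (p : CommutativeRing.Carrier R) →
         Σ (Fin n → Graph n → ℤ) (λ X →
           ((G : Graph n) → T (isClique G σ) →
              (+ degS k G σ) - (+ dUp k G σ) ≡ sumOutside σ (λ t → X t G))
           ×
           ((a : Fin n → ℤ) →
              CommutativeRing._≈_ R
                (Prob.Pr R n p (λ G → isClique G σ
                   ∧ allB (λ t → (t ∈ᵇ σ) Data.Bool.∨ ⌊ X t G ℤP.≟ a t ⌋) (allFin n)))
                (CommutativeRing._*_ R (Prob.Pr R n p (λ G → isClique G σ))
                   (Prob.prodOutside R σ (λ t → Prob.qLaw R k p (a t))))))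
lemma4 k _ n σ ∣σ∣≡ R p =
  X σ , (λ G σ-clique → degS-dUp≡sumOutside G σ σ-clique ∣σ∣≡)
      , Probability.ℙ-clique∧outcomes R p σ ∣σ∣≡
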